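{- Let $T$ be a spanning tree of $G$, let $f_0$ be the unique feasible flow supported on $T$, and for $i\ge1$ let $f_i=f_{i-1}-\frac{\Delta_{e_i}(f_{i-1})}{R_{e_i}}c_{e_i}$, where $e_1,e_2,\dots\in E\setminus T$ are sampled independently with $\Pr[e_i=e]=p_e=\frac{R_e}{\tau(T)r_e}$. Then each $f_i$ is feasible and \[ \mathbb{E}[\xi(f_i)]-\xi(f^*)\le\Big(1-\frac{1}{\tau(T)}\Big)^{i}\big(\xi(f_0)-\xi(f^*)\big). \]
   Context: $G=(V,E,w)$ is a connected undirected graph with positive weights and resistances $r_e=1/w_e$; edges are oriented and $f(b,a)=-f(a,b)$. $B\in\mathbb{R}^{E\times V}$ is the incidence matrix ($B_{(a,b),a}=1$, $B_{(a,b),b}=-1$, else $0$), $R=\mathrm{diag}(r_e)$. Demand $\chi\in\mathbb{R}^V$ with $\sum_a\chi(a)=0$; $f$ feasible iff $B^Tf=\chi$; $\xi(f)=f^TRf$; $f^*$ is the feasible flow minimizing $\xi$. For a spanning tree $T$: $p_{(a,b)}\in\mathbb{R}^E$ is the unit flow from $a$ to $b$ along the unique tree path; for $e=(a,b)\in E\setminus T$, $c_e=\mathbf{1}_e+p_{(b,a)}$ (tree cycle vector), $R_e=c_e^TRc_e$, $\Delta_e(f)=f^TRc_e$, and $\tau(T)=\sum_{e\in E\setminus T}R_e/r_e$. -}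

module Defs where

open import Data.Nat as ℕ using (ℕ; _∸_)
open import Data.Fin as Fin using (Fin; _≟_)
open import Data.Bool using (Bool; true; false; if_then_else_)
open import Data.List using (List; []; _∷_; map; length; filter)
open import Data.List.Relation.Unary.Unique.Propositional using (Unique)
open import Data.Product using (_×_; _,_; proj₁; proj₂; ∃; Σ)
open import Relation.Nullary using (¬_; does)
open import Relation.Binary using (Rel; IsTotalOrder)
open import Relation.Binary.PropositionalEquality using (_≡_)
open import Algebra.Bundles using (CommutativeRing)
open import Level using (0ℓ)

-- Ordered fields (stdlib has no reals; ℝ is an instance of this record).

record OrderedField : Set₁ where
  field
    commutativeRing : CommutativeRing 0ℓ 0ℓ
  open CommutativeRing commutativeRing public hiding (zero)
  infix 4 _≤_
  infix 8 _⁻¹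
  field
    _≤_          : Rel Carrier 0ℓ
    isTotalOrder : IsTotalOrder _≈_ _≤_
    +-mono-≤     : ∀ {x y} z → x ≤ y → x + z ≤ y + z
    *-nonneg     : ∀ {x y} → 0# ≤ x → 0# ≤ y → 0# ≤ x * y
    _⁻¹          : Carrier → Carrier
    ⁻¹-inverse   : ∀ x → ¬ (x ≈ 0#) → x * x ⁻¹ ≈ 1#
    0≉1          : ¬ (0# ≈ 1#)

  _<_ : Rel Carrier 0ℓ
  x < y = (x ≤ y) × ¬ (x ≈ y)

  _÷_ : Carrier → Carrier → Carrier
  x ÷ y = x * y ⁻¹

  _^_ : Carrier → ℕ → Carrier
  x ^ ℕ.zero  = 1#
  x ^ ℕ.suc k = x * (x ^ k)

  ∑ : ∀ {k} → (Fin k → Carrier) → Carrier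
  ∑ {ℕ.zero}  g = 0#
  ∑ {ℕ.suc k} g = g Fin.zero + ∑ (λ i → g (Fin.suc i))

-- Electrical flows on a (multi)graph with vertex set Fin n and oriented
-- edges Fin m, edge e going from src e to tgt e, with weights w,
-- relative to an edge subset T (the spanning tree).

module Flows (F : OrderedField) (n m : ℕ) (src tgt : Fin m → Fin n)
             (w : Fin m → OrderedField.Carrier F) (T : Fin m → Bool) where
  open OrderedField F

  Vertex = Fin n
  Edge   = Fin m
  Flow   = Edge → Carrier

  δ : ∀ {k} → Fin k → Fin k → Carrier
  δ i j = if does (i ≟ j) then 1# else 0#

  r : Edge → Carrier
  r e = w e ⁻¹

  B : Edge → Vertex → Carrier
  B e v = δ (src e) v - δ (tgt e) v

  Feasible : (Vertex → Carrier) → Flow → Set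
  Feasible χ f = ∀ v → ∑ (λ e → B e v * f e) ≈ χ v

  ξ : Flow → Carrier
  ξ f = ∑ (λ e → f e * r e * f e)

  Step = Edge × Bool

  from : Step → Vertex
  from (e , true)  = src e
  from (e , false) = tgt e

  to : Step → Vertex
  to (e , true)  = tgt e
  to (e , false) = src e

  data TWalk : Vertex → Vertex → List Step → Set where
    []  : ∀ {a} → TWalk a a []
    _∷_ : ∀ {a b s ss} → T (proj₁ s) ≡ true × from s ≡ a →
          TWalk (to s) b ss → TWalk a b (s ∷ ss)

  visited : Vertex → List Step → List Vertex
  visited a ss = a ∷ map to ss

  TPath : Vertex → Vertex → List Step → Set
  TPath a b ss = TWalk a b ss × Unique (visited a ss)

  treeSize : ℕ
  treeSize = length (filter (λ e → T e Data.Bool.≟ true) (Data.List.allFin m))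
    where import Data.Bool
          import Data.List

  IsSpanningTree : Set
  IsSpanningTree = (∀ a b → ∃ λ ss → TPath a b ss) × treeSize ≡ n ∸ 1

  pathFlow : List Step → Flow
  pathFlow []             e = 0#
  pathFlow ((e' , d) ∷ ss) e =
    (if d then δ e' e else - δ e' e) + pathFlow ss e

  module Cycles (path : Edge → List Step) where
    -- path e is meant to be the tree path from tgt e to src e,
    -- so c_e = 1_e + p_{(b,a)} for e = (a,b)
    c : Edge → Flow
    c e e' = δ e e' + pathFlow (path e) e'

    Rc : Edge → Carrier
    Rc e = ∑ (λ e' → c e e' * r e' * c e e')

    Δ : Edge → Flow → Carrier
    Δ e f = ∑ (λ e' → f e' * r e' * c e e')

    τ : Carrier
    τ = ∑ (λ e → if T e then 0# else Rc e ÷ r e)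

    prob : Edge → Carrier
    prob e = Rc e ÷ (τ * r e)

    step : Edge → Flow → Flow
    step e f e' = f e' - (Δ e f ÷ Rc e) * c e e'

    run : List Edge → Flow → Flow
    run []       f = f
    run (e ∷ es) f = run es (step e f)

    -- 𝔼[ξ(f_i)] when starting from f, with e_1,…,e_i i.i.d. ~ p on E \ T
    𝔼ξ : ℕ → Flow → Carrier
    𝔼ξ ℕ.zero    f = ξ f
    𝔼ξ (ℕ.suc i) f = ∑ (λ e → if T e then 0# else prob e * 𝔼ξ i (step e f))

module Submission where

-- An update f ↦ f − (Δ_e(f)/R_e) c_e adds a multiple of the fundamental
-- cycle c_e of a non-tree edge e.  Since c_e is a circulation the update
-- preserves feasibility, and it lowers the energy by exactly Δ_e(f)²/R_e.
-- Every circulation g equals Σ_{e ∉ T} g_e c_e, because a circulation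
-- supported on a spanning tree vanishes (proved by pruning leaves).  Hence
-- ξ(f) − ξ(f*) ≤ Σ_{e ∉ T} Δ_e(f)²/r_e for every feasible f*, which is τ
-- times the expected energy decrease of one random update; so the expected
-- gap contracts by the factor 1 − 1/τ per update.

open import Defs
open import Level using (0ℓ)
open import Data.Nat as ℕ using (ℕ; zero; suc; _∸_)
import Data.Nat.Properties as ℕ
open import Data.Integer as ℤ using (ℤ; +_; -[1+_])
import Data.Integer.Properties as ℤ
open import Data.Sign as Sign using (Sign)
open import Data.Fin as Fin using (Fin; punchIn; punchOut)
import Data.Fin.Properties as Fin
open import Data.Bool using (Bool; true; false; if_then_else_; _∧_; not)
import Data.Bool.Properties as Bool
open import Data.List using (List; []; _∷_; length; filter; tabulate)
open import Data.List.Relation.Unary.All using (All; []; _∷_)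
open import Data.Maybe using (Maybe; just; nothing)
open import Data.Product using (_×_; _,_; proj₁; proj₂; ∃)
open import Data.Sum using (_⊎_; inj₁; inj₂; [_,_]′)
open import Data.Empty using (⊥-elim)
open import Function using (_∘_)
open import Relation.Nullary using (¬_; yes; no; does; _→-dec_)
open import Relation.Binary.PropositionalEquality as ≡ using (_≡_; _≢_)
open import Relation.Binary.Bundles using (Poset)
open import Relation.Binary.Structures using (IsTotalOrder)
open import Algebra.Bundles using (CommutativeRing; RawRing)
import Algebra.Solver.Ring
import Algebra.Solver.Ring.AlmostCommutativeRing as ACR
import Algebra.Properties.CommutativeSemigroup as CommutativeSemigroupProperties
import Relation.Binary.Reasoning.PartialOrder
import Relation.Binary.Reasoning.Setoid

-- The canonical map ℤ → R into a commutative ring R is a ring homomorphism.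
-- Feeding it to the standard library's ring solver yields a decision
-- procedure for polynomial identities with integer coefficients in R.
module IntegerRingSolver (R : CommutativeRing 0ℓ 0ℓ) where
  open CommutativeRing R
  open import Algebra.Properties.Ring ring using (-0#≈0#; -‿involutive; -‿+-comm; -‿distribʳ-*; -1*x≈-x)
  open import Algebra.Properties.Semiring.Mult semiring using (×-homo-+; ×1-homo-*) renaming (_×_ to _×ᴿ_)
  open import Relation.Binary.Reasoning.Setoid setoid
  open CommutativeSemigroupProperties +-commutativeSemigroup using () renaming (interchange to +-interchange)
  open CommutativeSemigroupProperties *-commutativeSemigroup using () renaming (interchange to *-interchange)

  ⟦_⟧ℤ : ℤ → Carrier
  ⟦ + k ⟧ℤ      = k ×ᴿ 1#
  ⟦ -[1+ k ] ⟧ℤ = - (suc k ×ᴿ 1#)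

  -- the subtraction a ⊖ b of naturals, on which integer addition is built
  ⊖-homo : ∀ a b → ⟦ a ℤ.⊖ b ⟧ℤ ≈ a ×ᴿ 1# - b ×ᴿ 1#
  ⊖-homo a ℕ.zero = begin
    ⟦ a ℤ.⊖ 0 ⟧ℤ    ≡⟨ ≡.cong ⟦_⟧ℤ (ℤ.⊖-≥ {a} ℕ.z≤n) ⟩
    a ×ᴿ 1#         ≈⟨ +-identityʳ _ ⟨
    a ×ᴿ 1# + 0#    ≈⟨ +-congˡ -0#≈0# ⟨
    a ×ᴿ 1# - 0#    ∎
  ⊖-homo ℕ.zero (suc b) = begin
    ⟦ 0 ℤ.⊖ suc b ⟧ℤ    ≡⟨ ≡.cong ⟦_⟧ℤ (ℤ.⊖-≤ {0} {suc b} ℕ.z≤n) ⟩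
    - (suc b ×ᴿ 1#)     ≈⟨ +-identityˡ _ ⟨
    0# - suc b ×ᴿ 1#    ∎
  ⊖-homo (suc a) (suc b) = begin
    ⟦ suc a ℤ.⊖ suc b ⟧ℤ               ≡⟨ ≡.cong ⟦_⟧ℤ (ℤ.[1+m]⊖[1+n]≡m⊖n a b) ⟩
    ⟦ a ℤ.⊖ b ⟧ℤ                       ≈⟨ ⊖-homo a b ⟩
    a ×ᴿ 1# - b ×ᴿ 1#                  ≈⟨ +-identityˡ _ ⟨
    0# + (a ×ᴿ 1# - b ×ᴿ 1#)           ≈⟨ +-congʳ (-‿inverseʳ 1#) ⟨
    (1# - 1#) + (a ×ᴿ 1# - b ×ᴿ 1#)    ≈⟨ +-interchange _ _ _ _ ⟩
    suc a ×ᴿ 1# + (- 1# - b ×ᴿ 1#)     ≈⟨ +-congˡ (-‿+-comm 1# (b ×ᴿ 1#)) ⟩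
    suc a ×ᴿ 1# - suc b ×ᴿ 1#          ∎

  +-homo : ∀ i j → ⟦ i ℤ.+ j ⟧ℤ ≈ ⟦ i ⟧ℤ + ⟦ j ⟧ℤ
  +-homo (+ a)     (+ b)     = ×-homo-+ 1# a b
  +-homo (+ a)     -[1+ b ]  = ⊖-homo a (suc b)
  +-homo -[1+ a ]  (+ b)     = trans (⊖-homo b (suc a)) (+-comm _ _)
  +-homo -[1+ a ]  -[1+ b ]  = begin
    - (suc (suc (a ℕ.+ b)) ×ᴿ 1#)         ≡⟨ ≡.cong (λ k → - (k ×ᴿ 1#)) (≡.sym (ℕ.+-suc (suc a) b)) ⟩
    - ((suc a ℕ.+ suc b) ×ᴿ 1#)           ≈⟨ -‿cong (×-homo-+ 1# (suc a) (suc b)) ⟩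
    - (suc a ×ᴿ 1# + suc b ×ᴿ 1#)         ≈⟨ -‿+-comm _ _ ⟨
    - (suc a ×ᴿ 1#) + - (suc b ×ᴿ 1#)     ∎

  -‿homo : ∀ i → ⟦ ℤ.- i ⟧ℤ ≈ - ⟦ i ⟧ℤ
  -‿homo (+ ℕ.zero)  = sym -0#≈0#
  -‿homo (+ suc k)   = refl
  -‿homo -[1+ k ]    = sym (-‿involutive _)

  ⟦_⟧s : Sign → Carrier
  ⟦ Sign.+ ⟧s = 1#
  ⟦ Sign.- ⟧s = - 1#

  sign-homo : ∀ s t → ⟦ s Sign.* t ⟧s ≈ ⟦ s ⟧s * ⟦ t ⟧s
  sign-homo Sign.+ t      = sym (*-identityˡ _)
  sign-homo Sign.- Sign.+ = sym (*-identityʳ _)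
  sign-homo Sign.- Sign.- = begin
    1#             ≈⟨ -‿involutive 1# ⟨
    - - 1#         ≈⟨ -1*x≈-x (- 1#) ⟨
    - 1# * - 1#    ∎

  ◃-homo : ∀ s k → ⟦ s ℤ.◃ k ⟧ℤ ≈ ⟦ s ⟧s * k ×ᴿ 1#
  ◃-homo s      ℕ.zero  = sym (zeroʳ _)
  ◃-homo Sign.+ (suc k) = sym (*-identityˡ _)
  ◃-homo Sign.- (suc k) = sym (-1*x≈-x _)

  sign-abs : ∀ i → ⟦ i ⟧ℤ ≈ ⟦ ℤ.sign i ⟧s * ℤ.∣ i ∣ ×ᴿ 1#
  sign-abs (+ k)     = sym (*-identityˡ _)
  sign-abs -[1+ k ]  = sym (-1*x≈-x _)

  *-homo : ∀ i j → ⟦ i ℤ.* j ⟧ℤ ≈ ⟦ i ⟧ℤ * ⟦ j ⟧ℤ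
  *-homo i j = begin
    ⟦ i ℤ.* j ⟧ℤ                              ≈⟨ ◃-homo (s Sign.* t) (a ℕ.* b) ⟩
    ⟦ s Sign.* t ⟧s * (a ℕ.* b) ×ᴿ 1#         ≈⟨ *-cong (sign-homo s t) (×1-homo-* a b) ⟩
    (⟦ s ⟧s * ⟦ t ⟧s) * (a ×ᴿ 1# * b ×ᴿ 1#)   ≈⟨ *-interchange _ _ _ _ ⟩
    (⟦ s ⟧s * a ×ᴿ 1#) * (⟦ t ⟧s * b ×ᴿ 1#)   ≈⟨ *-cong (sign-abs i) (sign-abs j) ⟨
    ⟦ i ⟧ℤ * ⟦ j ⟧ℤ                           ∎
    where
    s t : Sign
    s = ℤ.sign i
    t = ℤ.sign j
    a b : ℕ
    a = ℤ.∣ i ∣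
    b = ℤ.∣ j ∣

  ℤ-rawRing : RawRing 0ℓ 0ℓ
  ℤ-rawRing = record { Carrier = ℤ ; _≈_ = _≡_ ; _+_ = ℤ._+_ ; _*_ = ℤ._*_ ; -_ = ℤ.-_ ; 0# = + 0 ; 1# = + 1 }

  homomorphism : ℤ-rawRing ACR.-Raw-AlmostCommutative⟶ ACR.fromCommutativeRing R
  homomorphism = record
    { ⟦_⟧ = ⟦_⟧ℤ ; +-homo = +-homo ; *-homo = *-homo ; -‿homo = -‿homo
    ; 0-homo = refl ; 1-homo = +-identityʳ 1# }

  ≟-coefficients : ∀ i j → Maybe (⟦ i ⟧ℤ ≈ ⟦ j ⟧ℤ)
  ≟-coefficients i j with i ℤ.≟ j
  ... | yes ≡.refl = just refl
  ... | no _       = nothing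

  open Algebra.Solver.Ring ℤ-rawRing (ACR.fromCommutativeRing R) homomorphism ≟-coefficients public
    using (solve; _:=_; _:+_; _:*_; _:-_; :-_)

-- Beyond the axioms of the record,
-- every inequality here follows from translation invariance of ≤ and the
-- closure of the nonnegative elements under multiplication.
module OrderedFieldFacts (F : OrderedField) where
  open OrderedField F public
  open IntegerRingSolver commutativeRing public using (solve; _:=_; _:+_; _:*_; _:-_; :-_)
  open import Algebra.Properties.Ring ring public
    using (-0#≈0#; -‿involutive; -‿+-comm; -‿distribʳ-*; -1*x≈-x; x∙y⁻¹≈ε⇒x≈y; x[y-z]≈xy-xz)
  open IsTotalOrder isTotalOrder public
    using (total; antisym)
    renaming (refl to ≤-refl; trans to ≤-trans; reflexive to ≤-reflexive;
              ≲-respˡ-≈ to ≤-respˡ-≈; ≲-respʳ-≈ to ≤-respʳ-≈)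

  open CommutativeSemigroupProperties *-commutativeSemigroup public using () renaming (interchange to *-interchange)
  open CommutativeSemigroupProperties +-commutativeSemigroup public using () renaming (interchange to +-interchange)

  ≤-poset : Poset _ _ _
  ≤-poset = record { isPartialOrder = IsTotalOrder.isPartialOrder isTotalOrder }

  module ≤-Reasoning = Relation.Binary.Reasoning.PartialOrder ≤-poset
  module ≈-Reasoning = Relation.Binary.Reasoning.Setoid setoid

  +-monoʳ-≤ : ∀ {x y} z → x ≤ y → z + x ≤ z + y
  +-monoʳ-≤ {x} {y} z x≤y = ≤-respˡ-≈ (+-comm x z) (≤-respʳ-≈ (+-comm y z) (+-mono-≤ z x≤y))

  +-mono₂-≤ : ∀ {a b c d} → a ≤ b → c ≤ d → a + c ≤ b + d
  +-mono₂-≤ {b = b} {c = c} a≤b c≤d = ≤-trans (+-mono-≤ c a≤b) (+-monoʳ-≤ b c≤d)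

  0≤-⇒≤ : ∀ {x y} → 0# ≤ y - x → x ≤ y
  0≤-⇒≤ {x} {y} 0≤y-x = begin
    x            ≈⟨ +-identityˡ x ⟨
    0# + x       ≤⟨ +-mono-≤ x 0≤y-x ⟩
    (y - x) + x  ≈⟨ solve 2 (λ x y → (y :- x) :+ x := y) refl x y ⟩
    y            ∎
    where open ≤-Reasoning

  ≤⇒0≤- : ∀ {x y} → x ≤ y → 0# ≤ y - x
  ≤⇒0≤- {x} {y} x≤y = begin
    0#      ≈⟨ -‿inverseʳ x ⟨
    x - x   ≤⟨ +-mono-≤ (- x) x≤y ⟩
    y - x   ∎
    where open ≤-Reasoning

  neg-antitone : ∀ {x y} → x ≤ y → - y ≤ - x
  neg-antitone {x} {y} x≤y = 0≤-⇒≤ (begin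
    0#           ≤⟨ ≤⇒0≤- x≤y ⟩
    y - x        ≈⟨ solve 2 (λ x y → y :- x := :- x :- :- y) refl x y ⟩
    - x - - y    ∎)
    where open ≤-Reasoning

  *-monoʳ-≤ : ∀ {x y z} → 0# ≤ z → x ≤ y → x * z ≤ y * z
  *-monoʳ-≤ {x} {y} {z} 0≤z x≤y = 0≤-⇒≤ (begin
    0#              ≤⟨ *-nonneg (≤⇒0≤- x≤y) 0≤z ⟩
    (y - x) * z     ≈⟨ solve 3 (λ x y z → (y :- x) :* z := y :* z :- x :* z) refl x y z ⟩
    y * z - x * z   ∎)
    where open ≤-Reasoning

  *-monoˡ-≤ : ∀ {x y z} → 0# ≤ z → x ≤ y → z * x ≤ z * y
  *-monoˡ-≤ {x} {y} {z} 0≤z x≤y = ≤-respˡ-≈ (*-comm x z) (≤-respʳ-≈ (*-comm y z) (*-monoʳ-≤ 0≤z x≤y))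

  -- squares are nonnegative: x * x = (- x) * (- x) and one of x, - x is
  -- nonnegative by totality
  x≤0⇒0≤-x : ∀ {x} → x ≤ 0# → 0# ≤ - x
  x≤0⇒0≤-x x≤0 = ≤-respˡ-≈ -0#≈0# (neg-antitone x≤0)

  sq-nonneg : ∀ x → 0# ≤ x * x
  sq-nonneg x with total 0# x
  ... | inj₁ 0≤x = *-nonneg 0≤x 0≤x
  ... | inj₂ x≤0 = ≤-respʳ-≈ (solve 1 (λ x → :- x :* :- x := x :* x) refl x)
                             (*-nonneg (x≤0⇒0≤-x x≤0) (x≤0⇒0≤-x x≤0))

  0≤1 : 0# ≤ 1#
  0≤1 = ≤-respʳ-≈ (*-identityˡ 1#) (sq-nonneg 1#)

  pos⇒≉0 : ∀ {x} → 0# < x → ¬ x ≈ 0#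
  pos⇒≉0 (_ , 0≉x) x≈0 = 0≉x (sym x≈0)

  <-≤-trans : ∀ {a b} → 0# < a → a ≤ b → 0# < b
  <-≤-trans (0≤a , 0≉a) a≤b = ≤-trans 0≤a a≤b , λ 0≈b → 0≉a (antisym 0≤a (≤-respʳ-≈ (sym 0≈b) a≤b))

  ⁻¹-pos : ∀ {x} → 0# < x → 0# < (x ⁻¹)
  ⁻¹-pos {x} 0<x@(0≤x , _) with total 0# (x ⁻¹)
  ... | inj₁ 0≤x⁻¹ = 0≤x⁻¹ , λ 0≈x⁻¹ → 0≉1 (begin
        0#          ≈⟨ zeroʳ x ⟨
        x * 0#      ≈⟨ *-congˡ 0≈x⁻¹ ⟩
        x * x ⁻¹    ≈⟨ ⁻¹-inverse x (pos⇒≉0 0<x) ⟩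
        1#          ∎)
    where open ≈-Reasoning
  ... | inj₂ x⁻¹≤0 = ⊥-elim (0≉1 (antisym 0≤1 (begin
        1#          ≈⟨ ⁻¹-inverse x (pos⇒≉0 0<x) ⟨
        x * x ⁻¹    ≤⟨ *-monoˡ-≤ 0≤x x⁻¹≤0 ⟩
        x * 0#      ≈⟨ zeroʳ x ⟩
        0#          ∎)))
    where open ≤-Reasoning

  product-inverse : ∀ {a b} → ¬ a ≈ 0# → ¬ b ≈ 0# → (a * b) * (a ⁻¹ * b ⁻¹) ≈ 1#
  product-inverse {a} {b} a≉0 b≉0 = begin
    (a * b) * (a ⁻¹ * b ⁻¹)   ≈⟨ *-interchange a b (a ⁻¹) (b ⁻¹) ⟩
    (a * a ⁻¹) * (b * b ⁻¹)   ≈⟨ *-cong (⁻¹-inverse a a≉0) (⁻¹-inverse b b≉0) ⟩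
    1# * 1#                   ≈⟨ *-identityˡ 1# ⟩
    1#                        ∎
    where open ≈-Reasoning

  *-≉0 : ∀ {a b} → ¬ a ≈ 0# → ¬ b ≈ 0# → ¬ a * b ≈ 0#
  *-≉0 {a} {b} a≉0 b≉0 ab≈0 = 0≉1 (begin
    0#                        ≈⟨ zeroˡ _ ⟨
    0# * (a ⁻¹ * b ⁻¹)        ≈⟨ *-congʳ ab≈0 ⟨
    (a * b) * (a ⁻¹ * b ⁻¹)   ≈⟨ product-inverse a≉0 b≉0 ⟩
    1#                        ∎)
    where open ≈-Reasoning

  ⁻¹-unique : ∀ {x y} → ¬ x ≈ 0# → x * y ≈ 1# → y ≈ x ⁻¹
  ⁻¹-unique {x} {y} x≉0 xy≈1 = begin
    y                  ≈⟨ *-identityʳ y ⟨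
    y * 1#             ≈⟨ *-congˡ (⁻¹-inverse x x≉0) ⟨
    y * (x * x ⁻¹)     ≈⟨ solve 3 (λ x y z → y :* (x :* z) := (x :* y) :* z) refl x y (x ⁻¹) ⟩
    (x * y) * x ⁻¹     ≈⟨ *-congʳ xy≈1 ⟩
    1# * x ⁻¹          ≈⟨ *-identityˡ _ ⟩
    x ⁻¹               ∎
    where open ≈-Reasoning

  ⁻¹-* : ∀ {a b} → ¬ a ≈ 0# → ¬ b ≈ 0# → (a * b) ⁻¹ ≈ a ⁻¹ * b ⁻¹
  ⁻¹-* a≉0 b≉0 = sym (⁻¹-unique (*-≉0 a≉0 b≉0) (product-inverse a≉0 b≉0))

  telescope : ∀ x y z → (x - y) + (y - z) ≈ x - z
  telescope = solve 3 (λ x y z → (x :- y) :+ (y :- z) := x :- z) refl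

  -- completing the square: for r > 0,  r g² + 2 g d ≥ - d² / r,
  -- since r (g + d/r)² ≥ 0
  complete-square : ∀ {r} → 0# < r → ∀ g d → - (d * d * r ⁻¹) ≤ r * (g * g) + (g * d + g * d)
  complete-square {r} 0<r g d = begin
    - (d * d * r ⁻¹)                                      ≈⟨ +-identityˡ _ ⟨
    0# - d * d * r ⁻¹                                     ≤⟨ +-mono-≤ _ (*-nonneg (sq-nonneg (r * g + d)) (proj₁ (⁻¹-pos 0<r))) ⟩
    (r * g + d) * (r * g + d) * r ⁻¹ - d * d * r ⁻¹        ≈⟨ expand ⟩
    (r * r ⁻¹) * (r * (g * g) + (g * d + g * d))          ≈⟨ *-congʳ (⁻¹-inverse r (pos⇒≉0 0<r)) ⟩
    1# * (r * (g * g) + (g * d + g * d))                  ≈⟨ *-identityˡ _ ⟩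
    r * (g * g) + (g * d + g * d)                         ∎
    where
    open ≤-Reasoning
    expand : (r * g + d) * (r * g + d) * r ⁻¹ - d * d * r ⁻¹ ≈ (r * r ⁻¹) * (r * (g * g) + (g * d + g * d))
    expand = solve 4 (λ r s g d → (r :* g :+ d) :* (r :* g :+ d) :* s :- d :* d :* s
                                  := (r :* s) :* (r :* (g :* g) :+ (g :* d :+ g :* d))) refl r (r ⁻¹) g d

module Sums (F : OrderedField) where
  open OrderedFieldFacts F
  open ≈-Reasoning

  ∑-cong : ∀ {k} {g h : Fin k → Carrier} → (∀ i → g i ≈ h i) → ∑ g ≈ ∑ h
  ∑-cong {ℕ.zero}  g≈h = refl
  ∑-cong {suc k}   g≈h = +-cong (g≈h Fin.zero) (∑-cong (λ i → g≈h (Fin.suc i)))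

  ∑-zero : ∀ {k} {g : Fin k → Carrier} → (∀ i → g i ≈ 0#) → ∑ g ≈ 0#
  ∑-zero {ℕ.zero}  g≈0 = refl
  ∑-zero {suc k}   g≈0 = trans (+-cong (g≈0 Fin.zero) (∑-zero (λ i → g≈0 (Fin.suc i)))) (+-identityˡ 0#)

  ∑-+ : ∀ {k} (g h : Fin k → Carrier) → ∑ (λ i → g i + h i) ≈ ∑ g + ∑ h
  ∑-+ {ℕ.zero} g h = sym (+-identityˡ 0#)
  ∑-+ {suc k}  g h = trans (+-congˡ (∑-+ (λ i → g (Fin.suc i)) (λ i → h (Fin.suc i))))
                           (+-interchange _ _ _ _)

  ∑-*ˡ : ∀ {k} a (g : Fin k → Carrier) → ∑ (λ i → a * g i) ≈ a * ∑ g
  ∑-*ˡ {ℕ.zero} a g = sym (zeroʳ a)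
  ∑-*ˡ {suc k}  a g = trans (+-congˡ (∑-*ˡ a (λ i → g (Fin.suc i)))) (sym (distribˡ a _ _))

  ∑-neg : ∀ {k} (g : Fin k → Carrier) → ∑ (λ i → - g i) ≈ - ∑ g
  ∑-neg {ℕ.zero} g = sym -0#≈0#
  ∑-neg {suc k}  g = trans (+-congˡ (∑-neg (λ i → g (Fin.suc i)))) (-‿+-comm _ _)

  ∑-- : ∀ {k} (g h : Fin k → Carrier) → ∑ (λ i → g i - h i) ≈ ∑ g - ∑ h
  ∑-- g h = trans (∑-+ g (λ i → - h i)) (+-congˡ (∑-neg h))

  ∑-comm : ∀ {k l} (g : Fin k → Fin l → Carrier) →
           ∑ (λ i → ∑ (λ j → g i j)) ≈ ∑ (λ j → ∑ (λ i → g i j))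
  ∑-comm {ℕ.zero} {l} g = sym (∑-zero {l} (λ _ → refl))
  ∑-comm {suc k}  g = trans (+-congˡ (∑-comm (λ i → g (Fin.suc i))))
                            (sym (∑-+ (g Fin.zero) (λ j → ∑ (λ i → g (Fin.suc i) j))))

  ∑-single : ∀ {k} (g : Fin k → Carrier) a → (∀ i → ¬ i ≡ a → g i ≈ 0#) → ∑ g ≈ g a
  ∑-single g Fin.zero others =
    trans (+-congˡ (∑-zero (λ i → others (Fin.suc i) (λ ())))) (+-identityʳ _)
  ∑-single g (Fin.suc a) others =
    trans (+-cong (others Fin.zero (λ ()))
                  (∑-single (λ i → g (Fin.suc i)) a (λ i i≢a → others (Fin.suc i) (λ 1+i≡1+a → i≢a (Fin.suc-injective 1+i≡1+a)))))
          (+-identityˡ _)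

  ∑-mono : ∀ {k} {g h : Fin k → Carrier} → (∀ i → g i ≤ h i) → ∑ g ≤ ∑ h
  ∑-mono {ℕ.zero} g≤h = ≤-refl
  ∑-mono {suc k}  g≤h = +-mono₂-≤ (g≤h Fin.zero) (∑-mono (λ i → g≤h (Fin.suc i)))

  ∑-nonneg : ∀ {k} {g : Fin k → Carrier} → (∀ i → 0# ≤ g i) → 0# ≤ ∑ g
  ∑-nonneg {k} 0≤g = ≤-respˡ-≈ (∑-zero {k} (λ _ → refl)) (∑-mono 0≤g)

  term≤∑ : ∀ {k} (g : Fin k → Carrier) → (∀ i → 0# ≤ g i) → ∀ a → g a ≤ ∑ g
  term≤∑ g 0≤g Fin.zero = ≤-respˡ-≈ (+-identityʳ _) (+-monoʳ-≤ (g Fin.zero) (∑-nonneg (λ i → 0≤g (Fin.suc i))))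
  term≤∑ g 0≤g (Fin.suc a) = ≤-trans (term≤∑ (λ i → g (Fin.suc i)) (λ i → 0≤g (Fin.suc i)) a)
                                     (≤-respˡ-≈ (+-identityˡ _) (+-mono-≤ _ (0≤g Fin.zero)))

  unless : Bool → Carrier → Carrier
  unless b x = if b then 0# else x

  unless-false : ∀ {b} x → b ≡ false → unless b x ≈ x
  unless-false x ≡.refl = refl

  unless-cong : ∀ b {x y} → (b ≡ false → x ≈ y) → unless b x ≈ unless b y
  unless-cong true  x≈y = refl
  unless-cong false x≈y = x≈y ≡.refl

  unless-zero : ∀ b {x} → (b ≡ false → x ≈ 0#) → unless b x ≈ 0#
  unless-zero true  x≈0 = refl
  unless-zero false x≈0 = x≈0 ≡.refl

  unless-*ˡ : ∀ b a x → a * unless b x ≈ unless b (a * x)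
  unless-*ˡ true  a x = zeroʳ a
  unless-*ˡ false a x = refl

  unless-+ : ∀ b x y → unless b x + unless b y ≈ unless b (x + y)
  unless-+ true  x y = +-identityʳ 0#
  unless-+ false x y = refl

  unless-neg : ∀ b x → - unless b x ≈ unless b (- x)
  unless-neg true  x = -0#≈0#
  unless-neg false x = refl

  unless-mono : ∀ b {x y} → (b ≡ false → x ≤ y) → unless b x ≤ unless b y
  unless-mono true  x≤y = ≤-refl
  unless-mono false x≤y = x≤y ≡.refl

  unless≤ : ∀ b {x} → 0# ≤ x → unless b x ≤ x
  unless≤ true  0≤x = 0≤x
  unless≤ false 0≤x = ≤-refl

  ∑-unless-+ : ∀ {k} (b : Fin k → Bool) (g h : Fin k → Carrier) →
               ∑ (λ i → unless (b i) (g i + h i)) ≈ ∑ (λ i → unless (b i) (g i)) + ∑ (λ i → unless (b i) (h i))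
  ∑-unless-+ b g h = trans (∑-cong (λ i → sym (unless-+ (b i) (g i) (h i)))) (∑-+ (λ i → unless (b i) (g i)) (λ i → unless (b i) (h i)))

  ∑-unless-neg : ∀ {k} (b : Fin k → Bool) (g : Fin k → Carrier) →
                 ∑ (λ i → unless (b i) (- g i)) ≈ - ∑ (λ i → unless (b i) (g i))
  ∑-unless-neg b g = trans (∑-cong (λ i → sym (unless-neg (b i) (g i)))) (∑-neg (λ i → unless (b i) (g i)))

  ∑-unless-- : ∀ {k} (b : Fin k → Bool) (g h : Fin k → Carrier) →
               ∑ (λ i → unless (b i) (g i - h i)) ≈ ∑ (λ i → unless (b i) (g i)) - ∑ (λ i → unless (b i) (h i))
  ∑-unless-- b g h = trans (∑-unless-+ b g (λ i → - h i)) (+-congˡ (∑-unless-neg b h))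

  ∑-unless-*ˡ : ∀ {k} (b : Fin k → Bool) a (g : Fin k → Carrier) →
                ∑ (λ i → unless (b i) (a * g i)) ≈ a * ∑ (λ i → unless (b i) (g i))
  ∑-unless-*ˡ b a g = trans (∑-cong (λ i → sym (unless-*ˡ (b i) a (g i)))) (∑-*ˡ a (λ i → unless (b i) (g i)))

  ∑-unless-const : ∀ {k} b (g : Fin k → Carrier) → ∑ (λ i → unless b (g i)) ≈ unless b (∑ g)
  ∑-unless-const {k} true  g = ∑-zero {k} (λ _ → refl)
  ∑-unless-const     false g = refl

  ∑-unless-comm : ∀ {k l} (b : Fin l → Bool) (a : Fin k → Carrier) (x : Fin l → Fin k → Carrier) →
                  ∑ (λ d → a d * ∑ (λ e → unless (b e) (x e d))) ≈ ∑ (λ e → unless (b e) (∑ (λ d → a d * x e d)))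
  ∑-unless-comm b a x = begin
    ∑ (λ d → a d * ∑ (λ e → unless (b e) (x e d)))   ≈⟨ ∑-cong (λ d → sym (∑-*ˡ (a d) (λ e → unless (b e) (x e d)))) ⟩
    ∑ (λ d → ∑ (λ e → a d * unless (b e) (x e d)))   ≈⟨ ∑-comm (λ d e → a d * unless (b e) (x e d)) ⟩
    ∑ (λ e → ∑ (λ d → a d * unless (b e) (x e d)))   ≈⟨ ∑-cong (λ e → trans (∑-cong (λ d → unless-*ˡ (b e) (a d) (x e d)))
                                                                        (∑-unless-const (b e) (λ d → a d * x e d))) ⟩
    ∑ (λ e → unless (b e) (∑ (λ d → a d * x e d)))   ∎

module Counting where
  open import Data.Nat using (_+_; _*_; _≤_; z≤n)
  open ≡ using (refl; cong; cong₂; sym)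
  open import Algebra.Properties.Semiring.Sum ℕ.+-*-semiring public
    using (sum; sum-remove; ∑-comm; ∑-distrib-+; *-distribˡ-sum)

  [_] : Bool → ℕ
  [ true ]  = 1
  [ false ] = 0

  count : ∀ {k} → (Fin k → Bool) → ℕ
  count P = sum (λ i → [ P i ])

  _==_ : ∀ {k} → Fin k → Fin k → Bool
  i == j = does (i Fin.≟ j)

  ==-refl : ∀ {k} (i : Fin k) → (i == i) ≡ true
  ==-refl i with i Fin.≟ i
  ... | yes _   = refl
  ... | no i≢i  = ⊥-elim (i≢i refl)

  ==-false : ∀ {k} {i j : Fin k} → i ≢ j → (i == j) ≡ false
  ==-false {i = i} {j} i≢j with i Fin.≟ j
  ... | yes i≡j = ⊥-elim (i≢j i≡j)
  ... | no _    = refl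

  sum-cong : ∀ {k} {g h : Fin k → ℕ} → (∀ i → g i ≡ h i) → sum g ≡ sum h
  sum-cong {zero}  g≡h = refl
  sum-cong {suc k} g≡h = ≡.cong₂ _+_ (g≡h Fin.zero) (sum-cong (g≡h ∘ Fin.suc))

  sum-zero : ∀ {k} {g : Fin k → ℕ} → (∀ i → g i ≡ 0) → sum g ≡ 0
  sum-zero {zero}  g≡0 = refl
  sum-zero {suc k} g≡0 = cong₂ _+_ (g≡0 Fin.zero) (sum-zero (g≡0 ∘ Fin.suc))

  sum-single : ∀ {k} (g : Fin k → ℕ) a → (∀ i → i ≢ a → g i ≡ 0) → sum g ≡ g a
  sum-single g Fin.zero others =
    ≡.trans (cong (λ s → g Fin.zero + s) (sum-zero (λ i → others (Fin.suc i) (λ ())))) (ℕ.+-identityʳ _)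
  sum-single g (Fin.suc a) others =
    cong₂ _+_ (others Fin.zero (λ ())) (sum-single (g ∘ Fin.suc) a (λ i i≢a → others (Fin.suc i) (i≢a ∘ Fin.suc-injective)))

  sum-mono : ∀ {k} {g h : Fin k → ℕ} → (∀ i → g i ≤ h i) → sum g ≤ sum h
  sum-mono {zero}  g≤h = z≤n
  sum-mono {suc k} g≤h = ℕ.+-mono-≤ (g≤h Fin.zero) (sum-mono (g≤h ∘ Fin.suc))

  term≤sum : ∀ {k} (g : Fin k → ℕ) a → g a ≤ sum g
  term≤sum {suc k} g a = ≡.subst (g a ≤_) (sym (sum-remove {i = a} g)) (ℕ.m≤m+n _ _)

  two-terms≤sum : ∀ {k} (g : Fin k → ℕ) a b → a ≢ b → g a + g b ≤ sum g
  two-terms≤sum {suc k} g a b a≢b = ≡.subst (g a + g b ≤_) (sym (sum-remove {i = a} g))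
    (ℕ.+-monoʳ-≤ (g a) (≡.subst (_≤ sum (g ∘ punchIn a)) (cong g (Fin.punchIn-punchOut a≢b))
                                (term≤sum (g ∘ punchIn a) (punchOut a≢b))))

  count-all : ∀ k → count {k} (λ _ → true) ≡ k
  count-all zero    = refl
  count-all (suc k) = cong suc (count-all k)

  count-witness : ∀ {k} (P : Fin k → Bool) → count P ≢ 0 → ∃ λ a → P a ≡ true
  count-witness {zero}  P count≢0 = ⊥-elim (count≢0 refl)
  count-witness {suc k} P count≢0 with P Fin.zero in P0
  ... | true  = Fin.zero , P0
  ... | false = let a , Pa = count-witness (P ∘ Fin.suc) count≢0 in Fin.suc a , Pa

  _∖_ : ∀ {k} → (Fin k → Bool) → Fin k → Fin k → Bool
  (P ∖ a) i = P i ∧ not (i == a)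

  ∖-sound : ∀ {k} (P : Fin k → Bool) a i → (P ∖ a) i ≡ true → P i ≡ true × i ≢ a
  ∖-sound P a i eq with P i | i Fin.≟ a
  ... | true | no i≢a = refl , i≢a

  ∖-complete : ∀ {k} (P : Fin k → Bool) {a i} → P i ≡ true → i ≢ a → (P ∖ a) i ≡ true
  ∖-complete P {a} {i} Pi i≢a rewrite Pi | ==-false i≢a = refl

  ∖-false : ∀ {k} (P : Fin k → Bool) a i → (P ∖ a) i ≡ false → P i ≡ false ⊎ i ≡ a
  ∖-false P a i eq with P i | i Fin.≟ a
  ... | false | _        = inj₁ refl
  ... | true  | yes i≡a  = inj₂ i≡a

  count-∖ : ∀ {k} (P : Fin k → Bool) a → P a ≡ true → count P ≡ suc (count (P ∖ a))
  count-∖ {suc k} P a Pa = begin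
    count P                                   ≡⟨ sum-remove {i = a} (λ i → [ P i ]) ⟩
    [ P a ] + sum (λ j → [ P (punchIn a j) ])  ≡⟨ cong₂ _+_ (cong [_] Pa) (sum-cong same) ⟩
    suc (sum (λ j → [ (P ∖ a) (punchIn a j) ]))  ≡⟨ cong (λ b → suc ([ b ] + sum (λ j → [ (P ∖ a) (punchIn a j) ]))) removed ⟨
    suc ([ (P ∖ a) a ] + sum (λ j → [ (P ∖ a) (punchIn a j) ])) ≡⟨ cong suc (sum-remove {i = a} (λ i → [ (P ∖ a) i ])) ⟨
    suc (count (P ∖ a)) ∎
    where
    open ≡.≡-Reasoning
    same : ∀ j → [ P (punchIn a j) ] ≡ [ (P ∖ a) (punchIn a j) ]
    same j rewrite ==-false (Fin.punchInᵢ≢i a j) | Bool.∧-identityʳ (P (punchIn a j)) = refl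
    removed : (P ∖ a) a ≡ false
    removed rewrite ==-refl a = Bool.∧-zeroʳ (P a)

  -- the size of the tree as computed in the definitions is a count
  length-filter : ∀ {k l} (P : Fin l → Bool) (f : Fin k → Fin l) →
    length (filter (λ e → P e Data.Bool.≟ true) (tabulate f)) ≡ count (P ∘ f)
  length-filter {zero}  P f = refl
  length-filter {suc k} P f with P (f Fin.zero)
  ... | true  = cong suc (length-filter P (f ∘ Fin.suc))
  ... | false = length-filter P (f ∘ Fin.suc)

module Leaves (n m : ℕ) (src tgt : Fin m → Fin n) where
  open Counting
  open import Data.Nat using (_+_; _*_; _<_; z≤n; s≤s)
  open ≡ using (refl)

  Vertex : Set
  Vertex = Fin n

  Edge : Set
  Edge = Fin m

  Crosses : (Vertex → Bool) → Edge → Set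
  Crosses X e = X (src e) ≢ X (tgt e)

  Connects : (Edge → Bool) → (Vertex → Bool) → Set
  Connects S U = ∀ X → (∃ λ x → U x ≡ true × X x ≡ true) → (∃ λ y → U y ≡ true × X y ≡ false) →
                 ∃ λ e → S e ≡ true × Crosses X e

  ends : Vertex → Edge → ℕ
  ends v e = [ src e == v ] + [ tgt e == v ]

  degree : (Edge → Bool) → Vertex → ℕ
  degree S v = sum (λ e → [ S e ] * ends v e)

  sum-== : ∀ (a : Vertex) → sum (λ v → [ a == v ]) ≡ 1
  sum-== a = ≡.trans (sum-single (λ v → [ a == v ]) a (λ v v≢a → ≡.cong [_] (==-false (v≢a ∘ ≡.sym))))
                     (≡.cong [_] (==-refl a))

  handshake : ∀ S → sum (degree S) ≡ 2 * count S
  handshake S = begin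
    sum (λ v → sum (λ e → [ S e ] * ends v e))  ≡⟨ ∑-comm {n} {m} (λ v e → [ S e ] * ends v e) ⟩
    sum (λ e → sum (λ v → [ S e ] * ends v e))  ≡⟨ sum-cong (λ e → *-distribˡ-sum [ S e ] (λ v → ends v e)) ⟨
    sum (λ e → [ S e ] * sum (λ v → ends v e))  ≡⟨ sum-cong (λ e → ≡.cong ([ S e ] *_) (two-ends e)) ⟩
    sum (λ e → [ S e ] * 2)                     ≡⟨ sum-cong (λ e → ℕ.*-comm [ S e ] 2) ⟩
    sum (λ e → 2 * [ S e ])                     ≡⟨ *-distribˡ-sum 2 (λ e → [ S e ]) ⟨
    2 * count S                                 ∎
    where
    open ≡.≡-Reasoning
    two-ends : ∀ e → sum (λ v → ends v e) ≡ 2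
    two-ends e = ≡.trans (∑-distrib-+ {n} (λ v → [ src e == v ]) (λ v → [ tgt e == v ]))
                         (≡.cong₂ _+_ (sum-== (src e)) (sum-== (tgt e)))

  leaf : ∀ S U → suc (count S) ≡ count U → ∃ λ v → U v ≡ true × degree S v < 2
  leaf S U size with Fin.¬∀⟶∃¬ n (λ v → U v ≡ true → 2 ℕ.≤ degree S v)
                                 (λ v → (U v Bool.≟ true) →-dec (2 ℕ.≤? degree S v)) all-large
    where
    all-large : ¬ (∀ v → U v ≡ true → 2 ℕ.≤ degree S v)
    all-large large = ℕ.<-irrefl refl (ℕ.*-cancelˡ-≤ 2 (begin
      2 * suc (count S)          ≡⟨ ≡.cong (2 *_) size ⟩
      2 * count U                ≡⟨ *-distribˡ-sum 2 (λ v → [ U v ]) ⟩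
      sum (λ v → 2 * [ U v ])    ≤⟨ sum-mono bound ⟩
      sum (degree S)             ≡⟨ handshake S ⟩
      2 * count S                ∎))
      where
      open ℕ.≤-Reasoning
      bound : ∀ v → 2 * [ U v ] ℕ.≤ degree S v
      bound v with U v | large v
      ... | true  | large-v = large-v refl
      ... | false | _       = z≤n
  ... | v , small with U v in Uv
  ...   | true  = v , Uv , ℕ.≰⇒> (λ 2≤d → small (λ _ → 2≤d))
  ...   | false = ⊥-elim (small (λ ()))

  record LeafEdge (S : Edge → Bool) (U : Vertex → Bool) : Set where
    field
      vertex  : Vertex
      edge    : Edge
      in-U    : U vertex ≡ true
      small   : degree S vertex < 2
      in-S    : S edge ≡ true
      crosses : Crosses (_== vertex) edge

  -- when S connects U and has an edge, the leaf is not all of U, so the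
  -- cut separating it from the rest of U supplies its edge
  leaf-edge : ∀ k S U → count S ≡ suc k → suc (count S) ≡ count U → Connects S U → LeafEdge S U
  leaf-edge k S U |S| size connects = record
    { vertex = v ; edge = proj₁ e×e∈S ; in-U = Uv ; small = small
    ; in-S = proj₁ (proj₂ e×e∈S) ; crosses = proj₂ (proj₂ e×e∈S) }
    where
    v×leaf : ∃ λ v → U v ≡ true × degree S v < 2
    v×leaf = leaf S U size
    v : Vertex
    v = proj₁ v×leaf
    Uv : U v ≡ true
    Uv = proj₁ (proj₂ v×leaf)
    small : degree S v < 2
    small = proj₂ (proj₂ v×leaf)
    |U∖v|≢0 : count (U ∖ v) ≢ 0
    |U∖v|≢0 |U∖v|≡0 = ℕ.1+n≢0 (ℕ.suc-injective (≡.trans (≡.trans (≡.cong suc (≡.sym |S|)) size)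
                                                       (≡.trans (count-∖ U v Uv) (≡.cong suc |U∖v|≡0))))
    y×y∈U∖v : ∃ λ y → (U ∖ v) y ≡ true
    y×y∈U∖v = count-witness (U ∖ v) |U∖v|≢0
    y∈U∖v : U (proj₁ y×y∈U∖v) ≡ true × proj₁ y×y∈U∖v ≢ v
    y∈U∖v = ∖-sound U v (proj₁ y×y∈U∖v) (proj₂ y×y∈U∖v)
    e×e∈S : ∃ λ e → S e ≡ true × Crosses (_== v) e
    e×e∈S = connects (_== v) (v , Uv , ==-refl v) (proj₁ y×y∈U∖v , proj₁ y∈U∖v , ==-false (proj₂ y∈U∖v))

  prune-sizes : ∀ {k} (S : Edge → Bool) (U : Vertex → Bool) v e → count S ≡ suc k → suc (count S) ≡ count U → U v ≡ true → S e ≡ true →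
                count (S ∖ e) ≡ k × suc (count (S ∖ e)) ≡ count (U ∖ v)
  prune-sizes {k} S U v e |S| size Uv Se =
    |S∖e| , ℕ.suc-injective (≡.trans (≡.cong suc (≡.cong suc |S∖e|)) (≡.trans (≡.cong suc (≡.sym |S|)) (≡.trans size (count-∖ U v Uv))))
    where
    |S∖e| : count (S ∖ e) ≡ k
    |S∖e| = ℕ.suc-injective (≡.trans (≡.sym (count-∖ S e Se)) |S|)

  Avoids : Vertex → Edge → Set
  Avoids v e = (src e == v) ≡ false × (tgt e == v) ≡ false

  avoids-or-ends : ∀ v e → Avoids v e ⊎ 1 ℕ.≤ ends v e
  avoids-or-ends v e with src e == v | tgt e == v
  ... | false | false = inj₁ (refl , refl)
  ... | false | true  = inj₂ (s≤s z≤n)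
  ... | true  | _     = inj₂ (s≤s z≤n)

  unique-leaf-edge : ∀ S v e → degree S v < 2 → S e ≡ true → 1 ℕ.≤ ends v e →
                     ∀ e′ → S e′ ≡ true → e′ ≢ e → Avoids v e′
  unique-leaf-edge S v e small Se e-at-v e′ Se′ e′≢e with avoids-or-ends v e′
  ... | inj₁ avoids  = avoids
  ... | inj₂ e′-at-v = ⊥-elim (ℕ.<-irrefl refl (ℕ.<-≤-trans small (begin
      2                                          ≡⟨⟩
      1 + 1                                      ≤⟨ ℕ.+-mono-≤ (at-v Se′ e′-at-v) (at-v Se e-at-v) ⟩
      [ S e′ ] * ends v e′ + [ S e ] * ends v e  ≤⟨ two-terms≤sum (λ d → [ S d ] * ends v d) e′ e e′≢e ⟩
      degree S v                                 ∎)))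
    where
    open ℕ.≤-Reasoning
    at-v : ∀ {d} → S d ≡ true → 1 ℕ.≤ ends v d → 1 ℕ.≤ [ S d ] * ends v d
    at-v {d} Sd 1≤ends rewrite Sd = ℕ.≤-trans 1≤ends (ℕ.m≤n*m (ends v d) 1)

  crossing-ends : ∀ v e → Crosses (_== v) e → 1 ℕ.≤ ends v e
  crossing-ends v e crosses with avoids-or-ends v e
  ... | inj₁ (s≢v , t≢v) = ⊥-elim (crosses (≡.trans s≢v (≡.sym t≢v)))
  ... | inj₂ e-at-v       = e-at-v

  extend : (Vertex → Bool) → Vertex → Vertex → Vertex → Bool
  extend X v u i = if i == v then X u else X i

  extend-away : ∀ X v u {i} → (i == v) ≡ false → extend X v u i ≡ X i
  extend-away X v u i≢v rewrite i≢v = refl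

  other : Vertex → Edge → Vertex
  other v e = if src e == v then tgt e else src e

  extend-uncrossed : ∀ X v e → Crosses (_== v) e → ¬ Crosses (extend X v (other v e)) e
  extend-uncrossed X v e crosses with src e == v | tgt e == v
  ... | true  | true  = ⊥-elim (crosses refl)
  ... | false | false = ⊥-elim (crosses refl)
  ... | true  | false = λ uncrossed → uncrossed refl
  ... | false | true  = λ uncrossed → uncrossed refl

  -- removing a leaf and its edge preserves connectivity: a bipartition X of
  -- U ∖ v extends to U by putting v on the side of the other end of e;
  -- an S-edge crossing the extension is not e, so avoids v and crosses X
  prune-connects : ∀ S U v e → degree S v < 2 → S e ≡ true → Crosses (_== v) e →
                   Connects S U → Connects (S ∖ e) (U ∖ v)
  prune-connects S U v e small Se crosses connects X (x , x∈U∖v , Xx) (y , y∈U∖v , Xy) =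
    e′ , ∖-complete S Se′ e′≢e , crosses-X
    where
    X′ : Vertex → Bool
    X′ = extend X v (other v e)
    on-U∖v : ∀ {z} → (U ∖ v) z ≡ true → U z ≡ true × X′ z ≡ X z
    on-U∖v {z} z∈ = proj₁ (∖-sound U v z z∈) , extend-away X v (other v e) (==-false (proj₂ (∖-sound U v z z∈)))
    crossing : ∃ λ e′ → S e′ ≡ true × Crosses X′ e′
    crossing = connects X′ (x , proj₁ (on-U∖v x∈U∖v) , ≡.trans (proj₂ (on-U∖v x∈U∖v)) Xx)
                           (y , proj₁ (on-U∖v y∈U∖v) , ≡.trans (proj₂ (on-U∖v y∈U∖v)) Xy)
    e′ : Edge
    e′ = proj₁ crossing
    Se′ : S e′ ≡ true
    Se′ = proj₁ (proj₂ crossing)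
    e′≢e : e′ ≢ e
    e′≢e e′≡e = extend-uncrossed X v e crosses (≡.subst (Crosses X′) e′≡e (proj₂ (proj₂ crossing)))
    avoids : Avoids v e′
    avoids = unique-leaf-edge S v e small Se (crossing-ends v e crosses) e′ Se′ e′≢e
    crosses-X : Crosses X e′
    crosses-X same = proj₂ (proj₂ crossing)
      (≡.trans (extend-away X v (other v e) (proj₁ avoids))
        (≡.trans same (≡.sym (extend-away X v (other v e) (proj₂ avoids)))))

-- A tree carries no nonzero circulation: if S connects U and |S| + 1 = |U|,
-- a flow supported on S and conserved at every vertex of U vanishes.  At a
-- leaf v with edge e the conservation law reads ±(flow on e) = 0, and
-- S ∖ e, U ∖ v satisfy the hypotheses again.
module TreeCirculations (F : OrderedField) (n m : ℕ) (src tgt : Fin m → Fin n)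
                        (w : Fin m → OrderedField.Carrier F) (T : Fin m → Bool) where
  open OrderedFieldFacts F
  open Sums F
  open Counting using (count; _==_; [_]; _∖_; ∖-sound; ∖-false; term≤sum; count-all; length-filter)
  open Leaves n m src tgt hiding (Vertex; Edge)
  open Flows F n m src tgt w T using (Vertex; Edge; Flow; B; TWalk; []; _∷_; from; to; IsSpanningTree; treeSize)

  -- B e v, written in terms of the incidence bits (src e == v), (tgt e == v)
  incidence : Bool → Bool → Carrier
  incidence a b = (if a then 1# else 0#) - (if b then 1# else 0#)

  B-avoids : ∀ v e → Avoids v e → B e v ≈ 0#
  B-avoids v e (s≢v , t≢v) = ≡.subst₂ (λ a b → incidence a b ≈ 0#) (≡.sym s≢v) (≡.sym t≢v) (-‿inverseʳ 0#)

  B-crossing : ∀ v e → Crosses (_== v) e → B e v * B e v ≈ 1#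
  B-crossing v e = ±1 (src e == v) (tgt e == v)
    where
    open ≈-Reasoning
    ±1 : ∀ a b → a ≢ b → incidence a b * incidence a b ≈ 1#
    ±1 true  true  a≢b = ⊥-elim (a≢b ≡.refl)
    ±1 false false a≢b = ⊥-elim (a≢b ≡.refl)
    ±1 true  false _   = begin
      (1# - 0#) * (1# - 0#)   ≈⟨ *-cong 1-0≈1 1-0≈1 ⟩
      1# * 1#                 ≈⟨ *-identityˡ 1# ⟩
      1#                      ∎
      where
      1-0≈1 : 1# - 0# ≈ 1#
      1-0≈1 = trans (+-congˡ -0#≈0#) (+-identityʳ 1#)
    ±1 false true  _   = begin
      (0# - 1#) * (0# - 1#)   ≈⟨ *-cong (+-identityˡ (- 1#)) (+-identityˡ (- 1#)) ⟩
      - 1# * - 1#             ≈⟨ -1*x≈-x (- 1#) ⟩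
      - - 1#                  ≈⟨ -‿involutive 1# ⟩
      1#                      ∎

  leaf-flow-zero : ∀ S v e (h : Flow) → degree S v ℕ.< 2 → S e ≡ true → Crosses (_== v) e →
                   (∀ d → S d ≡ false → h d ≈ 0#) → ∑ (λ d → B d v * h d) ≈ 0# → h e ≈ 0#
  leaf-flow-zero S v e h small Se crosses off-S conserved = begin
    h e                        ≈⟨ *-identityˡ (h e) ⟨
    1# * h e                   ≈⟨ *-congʳ (B-crossing v e crosses) ⟨
    (B e v * B e v) * h e      ≈⟨ *-assoc _ _ _ ⟩
    B e v * (B e v * h e)      ≈⟨ *-congˡ Bh≈0 ⟩
    B e v * 0#                 ≈⟨ zeroʳ _ ⟩
    0#                         ∎
    where
    open ≈-Reasoning
    others : ∀ d → d ≢ e → B d v * h d ≈ 0#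
    others d d≢e with S d in Sd
    ... | true  = trans (*-congʳ (B-avoids v d (unique-leaf-edge S v e small Se (crossing-ends v e crosses) d Sd d≢e))) (zeroˡ _)
    ... | false = trans (*-congˡ (off-S d Sd)) (zeroʳ _)
    Bh≈0 : B e v * h e ≈ 0#
    Bh≈0 = trans (sym (∑-single (λ d → B d v * h d) e others)) conserved

  tree-circulation-zero : ∀ k S U (h : Flow) → count S ≡ k → suc (count S) ≡ count U → Connects S U →
                          (∀ d → S d ≡ false → h d ≈ 0#) →
                          (∀ v → U v ≡ true → ∑ (λ d → B d v * h d) ≈ 0#) → ∀ d → h d ≈ 0#
  tree-circulation-zero zero S U h no-edges _ _ off-S _ d with S d in Sd
  ... | false = off-S d Sd
  ... | true  = ⊥-elim (ℕ.<-irrefl ≡.refl (≡.subst (1 ℕ.≤_) no-edges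
                  (≡.subst (λ b → [ b ] ℕ.≤ count S) Sd (term≤sum (λ i → [ S i ]) d))))
  tree-circulation-zero (suc k) S U h |S| size connects off-S conserved =
    tree-circulation-zero k (S ∖ e) (U ∖ v) h (proj₁ pruned) (proj₂ pruned)
      (prune-connects S U v e small in-S crosses connects) off-S∖e
      (λ u u∈U∖v → conserved u (proj₁ (∖-sound U v u u∈U∖v)))
    where
    open LeafEdge (leaf-edge k S U |S| size connects) renaming (vertex to v; edge to e)
    pruned : count (S ∖ e) ≡ k × suc (count (S ∖ e)) ≡ count (U ∖ v)
    pruned = prune-sizes S U v e |S| size in-U in-S
    he≈0 : h e ≈ 0#
    he≈0 = leaf-flow-zero S v e h small in-S crosses off-S (conserved v in-U)
    off-S∖e : ∀ d → (S ∖ e) d ≡ false → h d ≈ 0#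
    off-S∖e d d∉S∖e = [ off-S d , (λ d≡e → ≡.subst (λ x → h x ≈ 0#) (≡.sym d≡e) he≈0) ]′ (∖-false S e d d∉S∖e)

  true≢false : true ≢ false
  true≢false ()

  walk-crosses : ∀ X {a b ss} → TWalk a b ss → X a ≡ true → X b ≡ false → ∃ λ e → T e ≡ true × Crosses X e
  walk-crosses X [] Xa Xb = ⊥-elim (true≢false (≡.trans (≡.sym Xa) Xb))
  walk-crosses X (_∷_ {s = s} (Ts , ≡.refl) W) Xa Xb with X (to s) in Xto
  ... | true  = walk-crosses X W Xto Xb
  ... | false = proj₁ s , Ts , step-crosses s Xa Xto
    where
    step-crosses : ∀ s → X (from s) ≡ true → X (to s) ≡ false → Crosses X (proj₁ s)
    step-crosses (e , true)  Xs Xt same = true≢false (≡.trans (≡.sym Xs) (≡.trans same Xt))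
    step-crosses (e , false) Xt Xs same = true≢false (≡.trans (≡.sym Xt) (≡.trans (≡.sym same) Xs))

  spanning-tree-circulation-zero : IsSpanningTree → (h : Flow) → (∀ d → T d ≡ false → h d ≈ 0#) →
                                   (∀ v → ∑ (λ d → B d v * h d) ≈ 0#) → ∀ d → h d ≈ 0#
  spanning-tree-circulation-zero (paths , |T|≡n-1) h off-T conserved d =
    tree-circulation-zero (count T) T (λ _ → true) h ≡.refl size connects off-T (λ v _ → conserved v) d
    where
    connects : Connects T (λ _ → true)
    connects X (x , _ , Xx) (y , _ , Xy) = walk-crosses X (proj₁ (proj₂ (paths x y))) Xx Xy
    -- |T| = n - 1 and n ≥ 1, as src d is a vertex
    size : suc (count T) ≡ count {n} (λ _ → true)
    size = begin
      suc (count T)      ≡⟨ ≡.cong suc (length-filter T (λ e → e)) ⟨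
      suc treeSize       ≡⟨ ≡.cong suc |T|≡n-1 ⟩
      suc (n ∸ 1)        ≡⟨ inhabited (src d) ⟩
      n                  ≡⟨ count-all n ⟨
      count {n} (λ _ → true) ∎
      where
      open ≡.≡-Reasoning
      inhabited : ∀ {k} → Fin k → suc (k ∸ 1) ≡ k
      inhabited {suc k} _ = ≡.refl

-- The fundamental cycles c_e (e ∉ T) of the tree T and the update
-- f ↦ f − (Δ_e(f)/R_e) c_e: each c_e is a circulation which is 1 on e and
-- 0 on the other non-tree edges, so the update preserves feasibility and
-- lowers the energy by exactly Δ_e(f)²/R_e.
module FundamentalCycles (F : OrderedField) (n m : ℕ) (src tgt : Fin m → Fin n)
    (w : Fin m → OrderedField.Carrier F) (T : Fin m → Bool)
    (w-pos : ∀ e → OrderedField._<_ F (OrderedField.0# F) (w e))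
    (path : Fin m → List (Flows.Step F n m src tgt w T))
    (path-ok : ∀ e → T e ≡ false → Flows.TPath F n m src tgt w T (tgt e) (src e) (path e)) where
  open OrderedFieldFacts F
  open Sums F
  open Counting using (_==_; ==-refl; ==-false)
  open Flows F n m src tgt w T
  open Cycles path
  open TreeCirculations F n m src tgt w T using (spanning-tree-circulation-zero)
  open ≈-Reasoning

  outflow : Flow → Vertex → Carrier
  outflow h v = ∑ (λ d → B d v * h d)

  outflow-+ : ∀ x y v → outflow (λ d → x d + y d) v ≈ outflow x v + outflow y v
  outflow-+ x y v = trans (∑-cong (λ d → distribˡ (B d v) (x d) (y d))) (∑-+ (λ d → B d v * x d) (λ d → B d v * y d))

  outflow-*ˡ : ∀ a x v → outflow (λ d → a * x d) v ≈ a * outflow x v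
  outflow-*ˡ a x v = trans (∑-cong (λ d → solve 3 (λ b a x → b :* (a :* x) := a :* (b :* x)) refl (B d v) a (x d)))
                           (∑-*ˡ a (λ d → B d v * x d))

  outflow-- : ∀ x y v → outflow (λ d → x d - y d) v ≈ outflow x v - outflow y v
  outflow-- x y v = begin
    outflow (λ d → x d - y d) v                 ≈⟨ outflow-+ x (λ d → - y d) v ⟩
    outflow x v + outflow (λ d → - y d) v       ≈⟨ +-congˡ (∑-cong (λ d → sym (-‿distribʳ-* (B d v) (y d)))) ⟩
    outflow x v + ∑ (λ d → - (B d v * y d))     ≈⟨ +-congˡ (∑-neg (λ d → B d v * y d)) ⟩
    outflow x v - outflow y v                   ∎

  δ-same : ∀ {k} (i : Fin k) → δ i i ≈ 1#
  δ-same i = ≡.subst (λ b → (if b then 1# else 0#) ≈ 1#) (≡.sym (==-refl i)) refl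

  δ-diff : ∀ {k} {i j : Fin k} → i ≢ j → δ i j ≈ 0#
  δ-diff i≢j = ≡.subst (λ b → (if b then 1# else 0#) ≈ 0#) (≡.sym (==-false i≢j)) refl

  outflow-edge : ∀ e v → outflow (δ e) v ≈ B e v
  outflow-edge e v = begin
    ∑ (λ d → B d v * δ e d)   ≈⟨ ∑-single (λ d → B d v * δ e d) e (λ d d≢e → trans (*-congˡ (δ-diff (λ e≡d → d≢e (≡.sym e≡d)))) (zeroʳ _)) ⟩
    B e v * δ e e             ≈⟨ *-congˡ (δ-same e) ⟩
    B e v * 1#                ≈⟨ *-identityʳ _ ⟩
    B e v                     ∎

  walk-outflow : ∀ {a b ss} → TWalk a b ss → ∀ v → outflow (pathFlow ss) v ≈ δ a v - δ b v
  walk-outflow {a} [] v = trans (∑-zero (λ d → zeroʳ (B d v))) (sym (-‿inverseʳ (δ a v)))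
  walk-outflow {b = b} (_∷_ {s = (e , true)} {ss = ss} (_ , ≡.refl) W) v = begin
    outflow (λ d → δ e d + pathFlow ss d) v        ≈⟨ outflow-+ (δ e) (pathFlow ss) v ⟩
    outflow (δ e) v + outflow (pathFlow ss) v      ≈⟨ +-cong (outflow-edge e v) (walk-outflow W v) ⟩
    (δ (src e) v - δ (tgt e) v) + (δ (tgt e) v - δ b v)  ≈⟨ telescope _ _ _ ⟩
    δ (src e) v - δ b v                            ∎
  walk-outflow {b = b} (_∷_ {s = (e , false)} {ss = ss} (_ , ≡.refl) W) v = begin
    outflow (λ d → - δ e d + pathFlow ss d) v      ≈⟨ outflow-+ (λ d → - δ e d) (pathFlow ss) v ⟩
    outflow (λ d → - δ e d) v + outflow (pathFlow ss) v  ≈⟨ +-cong reversed (walk-outflow W v) ⟩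
    (δ (tgt e) v - δ (src e) v) + (δ (src e) v - δ b v)  ≈⟨ telescope _ _ _ ⟩
    δ (tgt e) v - δ b v                            ∎
    where
    reversed : outflow (λ d → - δ e d) v ≈ δ (tgt e) v - δ (src e) v
    reversed = begin
      ∑ (λ d → B d v * - δ e d)     ≈⟨ ∑-cong (λ d → sym (-‿distribʳ-* (B d v) (δ e d))) ⟩
      ∑ (λ d → - (B d v * δ e d))   ≈⟨ ∑-neg (λ d → B d v * δ e d) ⟩
      - outflow (δ e) v             ≈⟨ -‿cong (outflow-edge e v) ⟩
      - (δ (src e) v - δ (tgt e) v) ≈⟨ solve 2 (λ s t → :- (s :- t) := t :- s) refl (δ (src e) v) (δ (tgt e) v) ⟩
      δ (tgt e) v - δ (src e) v     ∎

  walk-off-tree : ∀ {a b ss} → TWalk a b ss → ∀ d → T d ≡ false → pathFlow ss d ≈ 0#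
  walk-off-tree [] d Td = refl
  walk-off-tree (_∷_ {s = (e , dir)} (Te , _) W) d Td =
    trans (+-cong (vanishes dir) (walk-off-tree W d Td)) (+-identityʳ 0#)
    where
    e≢d : e ≢ d
    e≢d e≡d with ≡.trans (≡.sym Te) (≡.trans (≡.cong T e≡d) Td)
    ... | ()
    vanishes : ∀ dir → (if dir then δ e d else - δ e d) ≈ 0#
    vanishes true  = δ-diff e≢d
    vanishes false = trans (-‿cong (δ-diff e≢d)) -0#≈0#

  cycle-circulation : ∀ e → T e ≡ false → ∀ v → outflow (c e) v ≈ 0#
  cycle-circulation e Te v = begin
    outflow (λ d → δ e d + pathFlow (path e) d) v                   ≈⟨ outflow-+ (δ e) (pathFlow (path e)) v ⟩
    outflow (δ e) v + outflow (pathFlow (path e)) v                 ≈⟨ +-cong (outflow-edge e v) (walk-outflow (proj₁ (path-ok e Te)) v) ⟩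
    (δ (src e) v - δ (tgt e) v) + (δ (tgt e) v - δ (src e) v)       ≈⟨ telescope _ _ _ ⟩
    δ (src e) v - δ (src e) v                                       ≈⟨ -‿inverseʳ _ ⟩
    0#                                                              ∎

  cycle-self : ∀ e → T e ≡ false → c e e ≈ 1#
  cycle-self e Te = trans (+-cong (δ-same e) (walk-off-tree (proj₁ (path-ok e Te)) e Te)) (+-identityʳ 1#)

  cycle-other : ∀ e d → T e ≡ false → T d ≡ false → e ≢ d → c e d ≈ 0#
  cycle-other e d Te Td e≢d = trans (+-cong (δ-diff e≢d) (walk-off-tree (proj₁ (path-ok e Te)) d Td)) (+-identityʳ 0#)

  step-feasible : ∀ χ f e → T e ≡ false → Feasible χ f → Feasible χ (step e f)
  step-feasible χ f e Te feasible v = begin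
    outflow (λ d → f d - t * c e d) v     ≈⟨ outflow-- f (λ d → t * c e d) v ⟩
    outflow f v - outflow (λ d → t * c e d) v  ≈⟨ +-cong (feasible v) (-‿cong (outflow-*ˡ t (c e) v)) ⟩
    χ v - t * outflow (c e) v             ≈⟨ +-congˡ (-‿cong (trans (*-congˡ (cycle-circulation e Te v)) (zeroʳ t))) ⟩
    χ v - 0#                              ≈⟨ +-congˡ -0#≈0# ⟩
    χ v + 0#                              ≈⟨ +-identityʳ _ ⟩
    χ v                                   ∎
    where t = Δ e f ÷ Rc e

  run-feasible : ∀ χ es f → All (λ e → T e ≡ false) es → Feasible χ f → Feasible χ (run es f)
  run-feasible χ []       f []          feasible = feasible
  run-feasible χ (e ∷ es) f (Te ∷ offT) feasible = run-feasible χ es (step e f) offT (step-feasible χ f e Te feasible)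

  -- the energy inner product ⟪x , y⟫ = xᵀ R y; ξ f = ⟪f , f⟫, Δ e f = ⟪f , c e⟫, Rc e = ⟪c e , c e⟫
  ⟪_,_⟫ : Flow → Flow → Carrier
  ⟪ x , y ⟫ = ∑ (λ d → x d * r d * y d)

  energy-along : ∀ f x t → ξ (λ d → f d - t * x d) ≈ ξ f - (t * ⟪ f , x ⟫ + t * ⟪ f , x ⟫) + t * t * ξ x
  energy-along f x t = begin
    ∑ (λ d → (f d - t * x d) * r d * (f d - t * x d))      ≈⟨ ∑-cong (λ d → expand (f d) (x d) (r d)) ⟩
    ∑ (λ d → frf d - (t * frx d + t * frx d) + t * t * xrx d) ≈⟨ ∑-+ (λ d → frf d - (t * frx d + t * frx d)) (λ d → t * t * xrx d) ⟩
    ∑ (λ d → frf d - (t * frx d + t * frx d)) + ∑ (λ d → t * t * xrx d) ≈⟨ +-cong (∑-- frf (λ d → t * frx d + t * frx d)) (∑-*ˡ (t * t) xrx) ⟩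
    ξ f - ∑ (λ d → t * frx d + t * frx d) + t * t * ξ x   ≈⟨ +-congʳ (+-congˡ (-‿cong (trans (∑-+ (λ d → t * frx d) (λ d → t * frx d)) (+-cong (∑-*ˡ t frx) (∑-*ˡ t frx))))) ⟩
    ξ f - (t * ⟪ f , x ⟫ + t * ⟪ f , x ⟫) + t * t * ξ x   ∎
    where
    frf frx xrx : Flow
    frf d = f d * r d * f d
    frx d = f d * r d * x d
    xrx d = x d * r d * x d
    expand : ∀ f x r → (f - t * x) * r * (f - t * x) ≈ f * r * f - (t * (f * r * x) + t * (f * r * x)) + t * t * (x * r * x)
    expand f x r = solve 4 (λ f x r t → (f :- t :* x) :* r :* (f :- t :* x)
                                        := f :* r :* f :- (t :* (f :* r :* x) :+ t :* (f :* r :* x)) :+ t :* t :* (x :* r :* x))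
                           refl f x r t

  r-pos : ∀ e → 0# < r e
  r-pos e = ⁻¹-pos (w-pos e)

  energy-term-nonneg : ∀ (x : Flow) d → 0# ≤ x d * r d * x d
  energy-term-nonneg x d = ≤-respʳ-≈ (solve 2 (λ x r → r :* (x :* x) := x :* r :* x) refl (x d) (r d))
                                     (*-nonneg (proj₁ (r-pos d)) (sq-nonneg (x d)))

  -- the cycle of e contains e, so R_e ≥ r_e > 0
  r≤Rc : ∀ e → T e ≡ false → r e ≤ Rc e
  r≤Rc e Te = ≤-respˡ-≈ on-e (term≤∑ (λ d → c e d * r d * c e d) (energy-term-nonneg (c e)) e)
    where
    on-e : c e e * r e * c e e ≈ r e
    on-e = trans (*-cong (*-congʳ (cycle-self e Te)) (cycle-self e Te)) (trans (*-identityʳ _) (*-identityˡ _))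

  Rc-pos : ∀ e → T e ≡ false → 0# < Rc e
  Rc-pos e Te = <-≤-trans (r-pos e) (r≤Rc e Te)

  step-energy : ∀ e f → T e ≡ false → ξ (step e f) ≈ ξ f - Δ e f * Δ e f * Rc e ⁻¹
  step-energy e f Te = begin
    ξ (step e f)                                               ≈⟨ energy-along f (c e) t ⟩
    ξ f - (t * D + t * D) + t * t * R                          ≈⟨ solve 4 (λ x D S R → x :- (D :* S :* D :+ D :* S :* D) :+ D :* S :* (D :* S) :* R
                                                                                   := x :+ D :* D :* S :* (R :* S) :- (D :* D :* S :+ D :* D :* S)) refl (ξ f) D (R ⁻¹) R ⟩
    ξ f + D * D * R ⁻¹ * (R * R ⁻¹) - (D * D * R ⁻¹ + D * D * R ⁻¹)  ≈⟨ +-congʳ (+-congˡ (trans (*-congˡ (⁻¹-inverse R (pos⇒≉0 (Rc-pos e Te)))) (*-identityʳ _))) ⟩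
    ξ f + D * D * R ⁻¹ - (D * D * R ⁻¹ + D * D * R ⁻¹)          ≈⟨ solve 2 (λ x y → x :+ y :- (y :+ y) := x :- y) refl (ξ f) (D * D * R ⁻¹) ⟩
    ξ f - D * D * R ⁻¹                                         ∎
    where
    D R t : Carrier
    D = Δ e f
    R = Rc e
    t = D ÷ R

  cycle-sum : Flow → Flow
  cycle-sum g d = ∑ (λ e → unless (T e) (g e * c e d))

  cycle-sum-circulation : ∀ g v → outflow (cycle-sum g) v ≈ 0#
  cycle-sum-circulation g v = begin
    ∑ (λ d → B d v * ∑ (λ e → unless (T e) (g e * c e d)))   ≈⟨ ∑-unless-comm T (λ d → B d v) (λ e d → g e * c e d) ⟩
    ∑ (λ e → unless (T e) (outflow (λ d → g e * c e d) v))   ≈⟨ ∑-zero (λ e → unless-zero (T e) (λ Te →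
                                                                 trans (outflow-*ˡ (g e) (c e) v) (trans (*-congˡ (cycle-circulation e Te v)) (zeroʳ _)))) ⟩
    0#                                                        ∎

  cycle-sum-off-tree : ∀ g d → T d ≡ false → cycle-sum g d ≈ g d
  cycle-sum-off-tree g d Td = begin
    ∑ (λ e → unless (T e) (g e * c e d))   ≈⟨ ∑-single (λ e → unless (T e) (g e * c e d)) d others ⟩
    unless (T d) (g d * c d d)             ≈⟨ unless-false _ Td ⟩
    g d * c d d                            ≈⟨ *-congˡ (cycle-self d Td) ⟩
    g d * 1#                               ≈⟨ *-identityʳ _ ⟩
    g d                                    ∎
    where
    others : ∀ e → e ≢ d → unless (T e) (g e * c e d) ≈ 0#
    others e e≢d = unless-zero (T e) (λ Te → trans (*-congˡ (cycle-other e d Te Td e≢d)) (zeroʳ _))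

  -- every circulation is the combination of fundamental cycles given by its
  -- values off the tree, since the difference is a circulation on the tree
  cycle-decomposition : IsSpanningTree → ∀ g → (∀ v → outflow g v ≈ 0#) → ∀ d → g d ≈ cycle-sum g d
  cycle-decomposition span g circulation d =
    x∙y⁻¹≈ε⇒x≈y (g d) (cycle-sum g d) (spanning-tree-circulation-zero span (λ d → g d - cycle-sum g d)
      (λ d Td → trans (+-congˡ (-‿cong (cycle-sum-off-tree g d Td))) (-‿inverseʳ (g d)))
      (λ v → trans (outflow-- g (cycle-sum g) v) (trans (+-cong (circulation v) (-‿cong (cycle-sum-circulation g v))) (-‿inverseʳ 0#)))
      d)

  inner-circulation : IsSpanningTree → ∀ f g → (∀ v → outflow g v ≈ 0#) →
                      ⟪ f , g ⟫ ≈ ∑ (λ e → unless (T e) (g e * Δ e f))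
  inner-circulation span f g circulation = begin
    ∑ (λ d → f d * r d * g d)                                  ≈⟨ ∑-cong (λ d → *-congˡ (cycle-decomposition span g circulation d)) ⟩
    ∑ (λ d → f d * r d * ∑ (λ e → unless (T e) (g e * c e d)))  ≈⟨ ∑-unless-comm T (λ d → f d * r d) (λ e d → g e * c e d) ⟩
    ∑ (λ e → unless (T e) (∑ (λ d → f d * r d * (g e * c e d)))) ≈⟨ ∑-cong (λ e → unless-cong (T e) (λ _ → pull-out e)) ⟩
    ∑ (λ e → unless (T e) (g e * Δ e f))                        ∎
    where
    pull-out : ∀ e → ∑ (λ d → f d * r d * (g e * c e d)) ≈ g e * Δ e f
    pull-out e = trans (∑-cong (λ d → solve 4 (λ f r g c → f :* r :* (g :* c) := g :* (f :* r :* c)) refl (f d) (r d) (g e) (c e d)))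
                       (∑-*ˡ (g e) (λ d → f d * r d * c e d))

  energy-difference : ∀ x y → ξ y - ξ x ≈ (⟪ x , (λ d → y d - x d) ⟫ + ⟪ x , (λ d → y d - x d) ⟫) + ξ (λ d → y d - x d)
  energy-difference x y = begin
    ξ y - ξ x                                          ≈⟨ ∑-- (λ d → y d * r d * y d) (λ d → x d * r d * x d) ⟨
    ∑ (λ d → y d * r d * y d - x d * r d * x d)        ≈⟨ ∑-cong (λ d → expand (x d) (y d) (r d)) ⟩
    ∑ (λ d → (xrz d + xrz d) + zrz d)                  ≈⟨ ∑-+ (λ d → xrz d + xrz d) zrz ⟩
    ∑ (λ d → xrz d + xrz d) + ξ z                      ≈⟨ +-congʳ (∑-+ xrz xrz) ⟩
    (⟪ x , z ⟫ + ⟪ x , z ⟫) + ξ z                      ∎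
    where
    z xrz zrz : Flow
    z d = y d - x d
    xrz d = x d * r d * z d
    zrz d = z d * r d * z d
    expand : ∀ x y r → y * r * y - x * r * x ≈ (x * r * (y - x) + x * r * (y - x)) + (y - x) * r * (y - x)
    expand = solve 3 (λ x y r → y :* r :* y :- x :* r :* x := (x :* r :* (y :- x) :+ x :* r :* (y :- x)) :+ (y :- x) :* r :* (y :- x)) refl

-- Writing g = f* − f (a circulation),
-- ξ f* − ξ f = 2⟪f , g⟫ + ξ g ≥ Σ_{e ∉ T} (2 g_e Δ_e(f) + r_e g_e²), and each
-- summand is at least − Δ_e(f)² / r_e by completing the square.
module Suboptimality (F : OrderedField) (n m : ℕ) (src tgt : Fin m → Fin n)
    (w : Fin m → OrderedField.Carrier F) (T : Fin m → Bool)
    (w-pos : ∀ e → OrderedField._<_ F (OrderedField.0# F) (w e))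
    (path : Fin m → List (Flows.Step F n m src tgt w T))
    (path-ok : ∀ e → T e ≡ false → Flows.TPath F n m src tgt w T (tgt e) (src e) (path e)) where
  open OrderedFieldFacts F
  open Sums F
  open Flows F n m src tgt w T
  open Cycles path
  open FundamentalCycles F n m src tgt w T w-pos path path-ok
  open ≤-Reasoning

  energy-off-tree≤ : ∀ g → ∑ (λ e → unless (T e) (r e * (g e * g e))) ≤ ξ g
  energy-off-tree≤ g = ∑-mono (λ e → ≤-respʳ-≈ (solve 2 (λ g r → r :* (g :* g) := g :* r :* g) refl (g e) (r e))
                                               (unless≤ (T e) (*-nonneg (proj₁ (r-pos e)) (sq-nonneg (g e)))))

  G : Flow → Carrier
  G f = ∑ (λ e → unless (T e) (Δ e f * Δ e f * r e ⁻¹))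

  energy-gap : IsSpanningTree → ∀ χ f f* → Feasible χ f → Feasible χ f* → ξ f - ξ f* ≤ G f
  energy-gap span χ f f* f-feasible f*-feasible = begin
    ξ f - ξ f*        ≈⟨ solve 2 (λ a b → a :- b := :- (b :- a)) refl (ξ f) (ξ f*) ⟩
    - (ξ f* - ξ f)    ≤⟨ neg-antitone lower ⟩
    - - G f           ≈⟨ -‿involutive (G f) ⟩
    G f               ∎
    where
    g : Flow
    g d = f* d - f d
    circulation : ∀ v → outflow g v ≈ 0#
    circulation v = trans (outflow-- f* f v) (trans (+-cong (f*-feasible v) (-‿cong (f-feasible v))) (-‿inverseʳ (χ v)))
    gΔ : Carrier
    gΔ = ∑ (λ e → unless (T e) (g e * Δ e f))
    lower : - G f ≤ ξ f* - ξ f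
    lower = begin
      - G f                                                       ≈⟨ ∑-unless-neg T (λ e → Δ e f * Δ e f * r e ⁻¹) ⟨
      ∑ (λ e → unless (T e) (- (Δ e f * Δ e f * r e ⁻¹)))          ≤⟨ ∑-mono (λ e → unless-mono (T e) (λ _ → complete-square (r-pos e) (g e) (Δ e f))) ⟩
      ∑ (λ e → unless (T e) (r e * (g e * g e) + (g e * Δ e f + g e * Δ e f)))
                                                                  ≈⟨ ∑-unless-+ T (λ e → r e * (g e * g e)) (λ e → g e * Δ e f + g e * Δ e f) ⟩
      ∑ (λ e → unless (T e) (r e * (g e * g e))) + ∑ (λ e → unless (T e) (g e * Δ e f + g e * Δ e f))
                                                                  ≈⟨ +-congˡ (∑-unless-+ T (λ e → g e * Δ e f) (λ e → g e * Δ e f)) ⟩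
      ∑ (λ e → unless (T e) (r e * (g e * g e))) + (gΔ + gΔ)      ≤⟨ +-mono-≤ (gΔ + gΔ) (energy-off-tree≤ g) ⟩
      ξ g + (gΔ + gΔ)                                             ≈⟨ +-comm (ξ g) (gΔ + gΔ) ⟩
      (gΔ + gΔ) + ξ g                                             ≈⟨ +-congʳ (+-cong inner inner) ⟨
      (⟪ f , g ⟫ + ⟪ f , g ⟫) + ξ g                               ≈⟨ energy-difference f f* ⟨
      ξ f* - ξ f                                                  ∎
      where
      inner : ⟪ f , g ⟫ ≈ gΔ
      inner = inner-circulation span f g circulation

-- With q_e = R_e / r_e ≥ 1 and τ = Σ_{e ∉ T} q_e,
-- the sampling probabilities are p_e = q_e / τ.  By the energy decrease of
-- one update, the expected energy after one random update is
-- ξ f − G f / τ ≤ ξ f − (ξ f − ξ f*) / τ, so the gap to ξ f* contracts by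
-- the factor 1 − 1/τ in expectation, and by induction after i updates.
module Convergence (F : OrderedField) (n m : ℕ) (src tgt : Fin m → Fin n)
    (w : Fin m → OrderedField.Carrier F) (T : Fin m → Bool)
    (w-pos : ∀ e → OrderedField._<_ F (OrderedField.0# F) (w e))
    (path : Fin m → List (Flows.Step F n m src tgt w T))
    (path-ok : ∀ e → T e ≡ false → Flows.TPath F n m src tgt w T (tgt e) (src e) (path e))
    (span : Flows.IsSpanningTree F n m src tgt w T)
    (e₀ : Fin m) (Te₀ : T e₀ ≡ false) where
  open OrderedFieldFacts F
  open Sums F
  open Flows F n m src tgt w T
  open Cycles path
  open FundamentalCycles F n m src tgt w T w-pos path path-ok
  open Suboptimality F n m src tgt w T w-pos path path-ok

  q : Edge → Carrier
  q e = Rc e ÷ r e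

  1≤q : ∀ e → T e ≡ false → 1# ≤ q e
  1≤q e Te = ≤-respˡ-≈ (⁻¹-inverse (r e) (pos⇒≉0 (r-pos e))) (*-monoʳ-≤ (proj₁ (⁻¹-pos (r-pos e))) (r≤Rc e Te))

  1≤τ : 1# ≤ τ
  1≤τ = begin
    1#                              ≤⟨ 1≤q e₀ Te₀ ⟩
    q e₀                            ≈⟨ unless-false (q e₀) Te₀ ⟨
    unless (T e₀) (q e₀)            ≤⟨ term≤∑ (λ e → unless (T e) (q e)) q-nonneg e₀ ⟩
    τ                               ∎
    where
    open ≤-Reasoning
    q-nonneg : ∀ e → 0# ≤ unless (T e) (q e)
    q-nonneg e = ≤-respˡ-≈ (unless-zero (T e) (λ _ → refl)) (unless-mono (T e) (λ Te → ≤-trans 0≤1 (1≤q e Te)))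

  τ-pos : 0# < τ
  τ-pos = <-≤-trans (0≤1 , 0≉1) 1≤τ

  0≤τ⁻¹ : 0# ≤ τ ⁻¹
  0≤τ⁻¹ = proj₁ (⁻¹-pos τ-pos)

  ττ⁻¹≈1 : τ * τ ⁻¹ ≈ 1#
  ττ⁻¹≈1 = ⁻¹-inverse τ (pos⇒≉0 τ-pos)

  ρ : Carrier
  ρ = 1# - τ ⁻¹

  0≤ρ^ : ∀ i → 0# ≤ ρ ^ i
  0≤ρ^ zero    = 0≤1
  0≤ρ^ (suc i) = *-nonneg (≤⇒0≤- τ⁻¹≤1) (0≤ρ^ i)
    where
    τ⁻¹≤1 : τ ⁻¹ ≤ 1#
    τ⁻¹≤1 = begin
      τ ⁻¹          ≈⟨ *-identityˡ (τ ⁻¹) ⟨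
      1# * τ ⁻¹     ≤⟨ *-monoʳ-≤ 0≤τ⁻¹ 1≤τ ⟩
      τ * τ ⁻¹      ≈⟨ ττ⁻¹≈1 ⟩
      1#            ∎
      where open ≤-Reasoning

  prob≈ : ∀ e → prob e ≈ τ ⁻¹ * q e
  prob≈ e = begin
    Rc e * (τ * r e) ⁻¹          ≈⟨ *-congˡ (⁻¹-* (pos⇒≉0 τ-pos) (pos⇒≉0 (r-pos e))) ⟩
    Rc e * (τ ⁻¹ * r e ⁻¹)       ≈⟨ solve 3 (λ R s t → R :* (s :* t) := s :* (R :* t)) refl (Rc e) (τ ⁻¹) (r e ⁻¹) ⟩
    τ ⁻¹ * q e                   ∎
    where open ≈-Reasoning

  0≤prob : ∀ e → T e ≡ false → 0# ≤ prob e
  0≤prob e Te = ≤-respʳ-≈ (sym (prob≈ e)) (*-nonneg 0≤τ⁻¹ (≤-trans 0≤1 (1≤q e Te)))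

  -- expectation of x(e) for e drawn from p; 𝔼ξ (suc i) f = average (λ e → 𝔼ξ i (step e f))
  average : (Edge → Carrier) → Carrier
  average x = ∑ (λ e → unless (T e) (prob e * x e))

  average-cong : ∀ {x y} → (∀ e → T e ≡ false → x e ≈ y e) → average x ≈ average y
  average-cong x≈y = ∑-cong (λ e → unless-cong (T e) (λ Te → *-congˡ (x≈y e Te)))

  average-mono : ∀ {x y} → (∀ e → T e ≡ false → x e ≤ y e) → average x ≤ average y
  average-mono x≤y = ∑-mono (λ e → unless-mono (T e) (λ Te → *-monoˡ-≤ (0≤prob e Te) (x≤y e Te)))

  average-*ˡ : ∀ a x → average (λ e → a * x e) ≈ a * average x
  average-*ˡ a x = trans (∑-cong (λ e → unless-cong (T e) (λ _ → solve 3 (λ p a x → p :* (a :* x) := a :* (p :* x)) refl (prob e) a (x e))))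
                         (∑-unless-*ˡ T a (λ e → prob e * x e))

  average-- : ∀ x y → average (λ e → x e - y e) ≈ average x - average y
  average-- x y = trans (∑-cong (λ e → unless-cong (T e) (λ _ → x[y-z]≈xy-xz (prob e) (x e) (y e))))
                        (∑-unless-- T (λ e → prob e * x e) (λ e → prob e * y e))

  -- the probabilities sum to 1
  average-const : ∀ a → average (λ _ → a) ≈ a
  average-const a = begin
    ∑ (λ e → unless (T e) (prob e * a))          ≈⟨ ∑-cong (λ e → unless-cong (T e) (λ _ → trans (*-comm (prob e) a) (*-congˡ (prob≈ e)))) ⟩
    ∑ (λ e → unless (T e) (a * (τ ⁻¹ * q e)))    ≈⟨ ∑-unless-*ˡ T a (λ e → τ ⁻¹ * q e) ⟩
    a * ∑ (λ e → unless (T e) (τ ⁻¹ * q e))      ≈⟨ *-congˡ (∑-unless-*ˡ T (τ ⁻¹) q) ⟩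
    a * (τ ⁻¹ * τ)                               ≈⟨ *-congˡ (trans (*-comm (τ ⁻¹) τ) ττ⁻¹≈1) ⟩
    a * 1#                                       ≈⟨ *-identityʳ a ⟩
    a                                            ∎
    where open ≈-Reasoning

  expected-step-energy : ∀ f → average (λ e → ξ (step e f)) ≈ ξ f - τ ⁻¹ * G f
  expected-step-energy f = begin
    average (λ e → ξ (step e f))                           ≈⟨ average-cong (λ e Te → step-energy e f Te) ⟩
    average (λ e → ξ f - Δ e f * Δ e f * Rc e ⁻¹)           ≈⟨ average-- (λ _ → ξ f) (λ e → Δ e f * Δ e f * Rc e ⁻¹) ⟩
    average (λ _ → ξ f) - average (λ e → Δ e f * Δ e f * Rc e ⁻¹)  ≈⟨ +-cong (average-const (ξ f)) (-‿cong decrease) ⟩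
    ξ f - τ ⁻¹ * G f                                       ∎
    where
    open ≈-Reasoning
    per-edge : ∀ e → T e ≡ false → prob e * (Δ e f * Δ e f * Rc e ⁻¹) ≈ τ ⁻¹ * (Δ e f * Δ e f * r e ⁻¹)
    per-edge e Te = begin
      prob e * (Δ e f * Δ e f * Rc e ⁻¹)                    ≈⟨ *-congʳ (prob≈ e) ⟩
      τ ⁻¹ * (Rc e * r e ⁻¹) * (Δ e f * Δ e f * Rc e ⁻¹)    ≈⟨ solve 5 (λ s R t D S → s :* (R :* t) :* (D :* D :* S) := (R :* S) :* (s :* (D :* D :* t)))
                                                                      refl (τ ⁻¹) (Rc e) (r e ⁻¹) (Δ e f) (Rc e ⁻¹) ⟩
      (Rc e * Rc e ⁻¹) * (τ ⁻¹ * (Δ e f * Δ e f * r e ⁻¹))  ≈⟨ *-congʳ (⁻¹-inverse (Rc e) (pos⇒≉0 (Rc-pos e Te))) ⟩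
      1# * (τ ⁻¹ * (Δ e f * Δ e f * r e ⁻¹))                ≈⟨ *-identityˡ _ ⟩
      τ ⁻¹ * (Δ e f * Δ e f * r e ⁻¹)                       ∎
    decrease : average (λ e → Δ e f * Δ e f * Rc e ⁻¹) ≈ τ ⁻¹ * G f
    decrease = trans (∑-cong (λ e → unless-cong (T e) (per-edge e)))
                     (∑-unless-*ˡ T (τ ⁻¹) (λ e → Δ e f * Δ e f * r e ⁻¹))

  convergence : ∀ χ f* → Feasible χ f* → ∀ i f → Feasible χ f → 𝔼ξ i f - ξ f* ≤ (ρ ^ i) * (ξ f - ξ f*)
  convergence χ f* f*-feasible zero f _ = ≤-reflexive (sym (*-identityˡ _))
  convergence χ f* f*-feasible (suc i) f f-feasible = begin
    average (λ e → 𝔼ξ i (step e f)) - ξ f*                 ≈⟨ +-congˡ (-‿cong (average-const (ξ f*))) ⟨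
    average (λ e → 𝔼ξ i (step e f)) - average (λ _ → ξ f*) ≈⟨ average-- (λ e → 𝔼ξ i (step e f)) (λ _ → ξ f*) ⟨
    average (λ e → 𝔼ξ i (step e f) - ξ f*)                 ≤⟨ average-mono (λ e Te → convergence χ f* f*-feasible i (step e f) (step-feasible χ f e Te f-feasible)) ⟩
    average (λ e → ρ ^ i * (ξ (step e f) - ξ f*))          ≈⟨ average-*ˡ (ρ ^ i) (λ e → ξ (step e f) - ξ f*) ⟩
    ρ ^ i * average (λ e → ξ (step e f) - ξ f*)            ≈⟨ *-congˡ (average-- (λ e → ξ (step e f)) (λ _ → ξ f*)) ⟩
    ρ ^ i * (average (λ e → ξ (step e f)) - average (λ _ → ξ f*))  ≈⟨ *-congˡ (+-cong (expected-step-energy f) (-‿cong (average-const (ξ f*)))) ⟩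
    ρ ^ i * ((ξ f - τ ⁻¹ * G f) - ξ f*)                    ≤⟨ *-monoˡ-≤ (0≤ρ^ i) one-step ⟩
    ρ ^ i * (ρ * (ξ f - ξ f*))                             ≈⟨ solve 3 (λ x y z → x :* (y :* z) := (y :* x) :* z) refl (ρ ^ i) ρ (ξ f - ξ f*) ⟩
    ρ ^ suc i * (ξ f - ξ f*)                               ∎
    where
    open ≤-Reasoning
    gap : Carrier
    gap = ξ f - ξ f*
    -- G f ≥ ξ f − ξ f*
    one-step : (ξ f - τ ⁻¹ * G f) - ξ f* ≤ ρ * gap
    one-step = begin
      (ξ f - τ ⁻¹ * G f) - ξ f*   ≈⟨ solve 3 (λ x G y → x :- G :- y := (x :- y) :- G) refl (ξ f) (τ ⁻¹ * G f) (ξ f*) ⟩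
      gap - τ ⁻¹ * G f            ≤⟨ +-monoʳ-≤ gap (neg-antitone (*-monoˡ-≤ 0≤τ⁻¹ (energy-gap span χ f f* f-feasible f*-feasible))) ⟩
      gap - τ ⁻¹ * gap            ≈⟨ +-congʳ (*-identityˡ gap) ⟨
      1# * gap - τ ⁻¹ * gap       ≈⟨ solve 3 (λ o s g → o :* g :- s :* g := (o :- s) :* g) refl 1# (τ ⁻¹) gap ⟩
      ρ * gap                     ∎

mainTheorem4 :
    (F : OrderedField) → let open OrderedField F in
    (n m : ℕ) (src tgt : Fin m → Fin n) (w : Fin m → Carrier) →
    (∀ e → 0# < w e) →
    (T : Fin m → Bool) →
    let open Flows F n m src tgt w T in
    IsSpanningTree →
    (∃ λ e → T e ≡ false) →
    (path : Edge → List Step) →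
    (∀ e → T e ≡ false → TPath (tgt e) (src e) (path e)) →
    let open Cycles path in
    (χ : Vertex → Carrier) → ∑ χ ≈ 0# →
    (f₀ : Flow) → Feasible χ f₀ → (∀ e → T e ≡ false → f₀ e ≈ 0#) →
    (f* : Flow) → Feasible χ f* → (∀ g → Feasible χ g → ξ f* ≤ ξ g) →
    (∀ (es : List Edge) → All (λ e → T e ≡ false) es → Feasible χ (run es f₀))
    × (∀ (i : ℕ) → 𝔼ξ i f₀ - ξ f* ≤ ((1# - τ ⁻¹) ^ i) * (ξ f₀ - ξ f*))
-- The bound holds for every feasible starting flow and every feasible
-- comparison flow f*.
mainTheorem4 F n m src tgt w w-pos T span (e₀ , Te₀) path path-ok χ _ f₀ f₀-feasible _ f* f*-feasible _ =
  (λ es off-tree → run-feasible χ es f₀ off-tree f₀-feasible) ,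
  (λ i → convergence χ f* f*-feasible i f₀ f₀-feasible)
  where
  open FundamentalCycles F n m src tgt w T w-pos path path-ok using (run-feasible)
  open Convergence F n m src tgt w T w-pos path path-ok span e₀ Te₀ using (convergence)
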